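{- Let $t=t_0\to_{b_0}t_1\to_{b_1}\cdots$ be an infinite strongly converging reduction sequence of $001$-terms with limit $t'$, and let $P\rhd C\vdash t:T$ be a quantitative derivation. Let $P_0=P$ and let $P_{n+1}$ be the reduct of $P_n$ at $b_n$ (so $P_n\to_{b_n}P_{n+1}$), with support $A_n$, contexts $C_n(a)$ and types $T_n(a)$. Let $A'$ be the set of $a\in\mathbb{N}^*$ such that $a\in A_n$ for all sufficiently large $n$ (for such $a$, $C_n(a)$ and $T_n(a)$ are constant for large $n$), and let $P'$ be the labelled tree with support $A'$ whose label at $a$ is $C_n(a)\vdash t'|_{\overline a}:T_n(a)$ for all sufficiently large $n$. Then $P'$ is a derivation.
   Context: Sequences: $\mathbb{N}^*$ finite sequences of naturals, $\varepsilon$ empty, $\cdot$ concatenation, $a\le b$ prefix order. $\mathrm{ad}(a)$ is the number of entries $\ge2$ of $a$; the collapse $\overline a$ replaces each entry $\ge2$ by $2$. Terms: $\Lambda^{111}$ = possibly infinite $\lambda$-terms $t,u::=x\mid\lambda x.t\mid tu$ (coinductive, up to $\alpha$-equivalence), identified with parsing trees: $\mathrm{supp}(x)=\{\varepsilon\}$, $\mathrm{supp}(\lambda x.t)=\{\varepsilon\}\cup0\cdot\mathrm{supp}(t)$, $\mathrm{supp}(tu)=\{\varepsilon\}\cup1\cdot\mathrm{supp}(t)\cup2\cdot\mathrm{supp}(u)$; $t(p)$ label, $t|_p$ subterm at $p$. $\Lambda^{001}$: terms every infinite branch of whose support has infinitely many entries $2$. $t\to_bt'$: $t|_b=(\lambda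 x.r)s$ and $t'$ is $t$ with that subterm replaced by $r[s/x]$. An infinite sequence $t_0\to_{b_0}t_1\to_{b_1}\cdots$ is strongly converging if $\mathrm{ad}(b_n)\to\infty$; its limit $t'$ is defined by: $p\in\mathrm{supp}(t')$ iff $p\in\mathrm{supp}(t_n)$ for all large $n$, and then $t'(p)=t_n(p)$ for all large $n$. Types: mutually coinductive $T::=\alpha\mid F\to T$, $F::=(T_k)_{k\in K}$, $K\subseteq\mathbb{N}\setminus\{0,1\}$ ($\mathrm{Rt}(F)=K$), syntactic equality; $\mathrm{supp}(\alpha)=\{\varepsilon\}$, $\mathrm{supp}(F\to T)=\{\varepsilon\}\cup\mathrm{supp}(F)\cup1\cdot\mathrm{supp}(T)$, $\mathrm{supp}((T_k)_k)=\bigcup_kk\cdot\mathrm{supp}(T_k)$, no infinite branch ending in $1^\omega$. $()$ empty sequence type; $k\cdot T$ single component $T$ at index $k$; disjoint sequence types have a join collecting all components. Contexts map variables to sequence types; $C-x$ resets $x$ to $()$; joins pointwise. Derivations: possibly infinite trees of judgments $C\vdash t:T$ generated coinductively by (ax) $x:k\cdot T\vdash x:T$, $k\ge2$ (axiom track $k$); (abs) from $C\vdash t:T$ infer $C-x\vdash\lambda x.t:C(x)\to T$; (app) from $C\vdash t:(S_k)_{k\in K}\to T$ and for each $k\in K$ a track $k$ premise $D_k\vdash u:S_k$, infer $C\cup\bigcup_kD_k\vdash tu:T$, with $C$ and the $D_k$ pairwise disjoint. Support: $\{\varepsilon\}$ for an axiom, $\{\varepsilon\}\cup0\cdot\mathrm{supp}(P_0)$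 for (abs), $\{\varepsilon\}\cup1\cdot\mathrm{supp}(P_1)\cup\bigcup_kk\cdot\mathrm{supp}(P_k)$ for (app); judgment at $a$ is $C(a)\vdash t|_{\overline a}:T(a)$. Quantitativity: $\mathrm{Ax}(a)(x)$ is the set of positions $a'\ge a$ with $t(\overline{a'})=x$ where this occurrence is free in $t|_{\overline a}$ (empty if $x$ not free there); $\mathrm{tr}(a')$ is the axiom track at $a'$. $P$ is quantitative if each $C(a)(x)$ is the join of the $\mathrm{tr}(a')\cdot T(a')$, $a'\in\mathrm{Ax}(a)(x)$. Reduction of derivations: let $t|_b=(\lambda x.r)s$, $P\rhd C\vdash t:T$ with support $A$. For each $a\in A$ with $\overline a=b$, the rule at $a$ is (app), its left premise at $a\cdot1$ is (abs) with premise $P_r$ at $a\cdot10$, its track $k$ premises ($k\in K_a$) are derivations $P^a_k$ typing $s$ with contexts $D^a_k$; for each $k$ at most one axiom leaf of $P_r$ types this bound $x$ with track $k$, say at $a\cdot10\cdot a_k$. The reduct ($P\to_bP'$) is obtained by, simultaneously for all such $a$: replacing the subderivation at $a$ by $P_r$ in which each axiom leaf of $x$ with track $k$ is replaced by $P^a_k$ (unmatched $P^a_k$ are discarded), replacing each context $C(\alpha)$ at positions $\alpha$ of $P_r$ by $(C(\alpha)-x)\cup\bigcup_{k\in\mathrm{Rt}(C(\alpha)(x))}D^a_k$, keeping types, and updating subjects; position $a\cdot10\cdot\alpha_0$ moves to $a\cdot\alpha_0$, $a\cdot k\cdot\alpha_0$ to $a\cdot a_k\cdot\alpha_0$, and positions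 $\alpha$ with $b\not\le\overline\alpha$ are unchanged. -}

module Defs where

open import Data.Nat using (ℕ; zero; suc; _+_; _∸_; _≤_; _≤ᵇ_; _<ᵇ_; _≡ᵇ_)
open import Data.Bool using (Bool; true; false; if_then_else_)
open import Data.List using (List; []; _∷_; _++_; _∷ʳ_; applyUpTo; replicate; map)
open import Data.Maybe using (Maybe; just; nothing; is-just)
import Data.Maybe as M
open import Data.Product using (Σ; _×_; _,_; ∃; ∃₂)
open import Data.Unit using (⊤)
open import Data.Empty using (⊥)
open import Relation.Binary.PropositionalEquality using (_≡_; _≢_)
open import Relation.Nullary using (¬_)

Pos : Set
Pos = List ℕ

_≼_ : Pos → Pos → Set
p ≼ q = Σ Pos (λ r → p ++ r ≡ q)

ad : Pos → ℕ
ad []      = 0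
ad (n ∷ a) = if 2 ≤ᵇ n then suc (ad a) else ad a

collapse : Pos → Pos
collapse = map (λ n → if 2 ≤ᵇ n then 2 else n)

-- number of entries equal to 0 (= number of binders crossed)
zeros : Pos → ℕ
zeros []            = 0
zeros (zero ∷ p)    = suc (zeros p)
zeros (suc _ ∷ p)   = zeros p

_↓ : {A : Set} → Maybe A → Set
x ↓ = x ≢ nothing

_at_ : {A : Set} → (Pos → A) → Pos → Pos → A
(t at p) q = t (p ++ q)

Eventually : (ℕ → Set) → Set
Eventually Q = ∃ λ N → ∀ n → N ≤ n → Q n

-- Possibly infinite λ-terms as parsing trees (de Bruijn labels,
-- so α-equivalent terms are literally equal)

data TmLbl : Set where
  var : ℕ → TmLbl
  lam : TmLbl
  app : TmLbl

Tm : Set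
Tm = Pos → Maybe TmLbl

TmNode : Tm → Pos → TmLbl → Set
TmNode t p (var _) = ∀ j → t (p ∷ʳ j) ≡ nothing
TmNode t p lam     = t (p ∷ʳ 0) ↓ × (∀ j → j ≢ 0 → t (p ∷ʳ j) ≡ nothing)
TmNode t p app     = t (p ∷ʳ 1) ↓ × t (p ∷ʳ 2) ↓ × (∀ j → j ≢ 1 → j ≢ 2 → t (p ∷ʳ j) ≡ nothing)

IsTerm : Tm → Set
IsTerm t = t [] ↓ × (∀ p j → t (p ∷ʳ j) ↓ → t p ↓) × (∀ p l → t p ≡ just l → TmNode t p l)

Is001 : Tm → Set
Is001 t = ∀ (f : ℕ → ℕ) → (∀ n → t (applyUpTo f n) ↓) → ∀ m → ∃ λ n → m ≤ n × f n ≡ 2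

shiftLbl : ℕ → ℕ → TmLbl → TmLbl
shiftLbl d e (var j) = if j <ᵇ e then var j else var (j + d)
shiftLbl d e lam     = lam
shiftLbl d e app     = app

shiftTm : ℕ → Tm → Tm
shiftTm d s p = M.map (shiftLbl d (zeros p)) (s p)

-- contract d r s  =  r[s/x] where x is index d at the current depth
-- (the outer binder of λx.r is removed)
contractVar : ℕ → ℕ → Tm → Pos → Maybe TmLbl
contractVar d i s p with i ≡ᵇ d
... | true  = shiftTm d s p
... | false with p
...   | []    = just (var (if i <ᵇ d then i else i ∸ 1))
...   | _ ∷ _ = nothing

contract : ℕ → Tm → Tm → Pos → Maybe TmLbl
contractLbl : ℕ → Tm → Tm → Pos → Maybe TmLbl → Maybe TmLbl
contract d r s p = contractLbl d r s p (r [])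
contractLbl d r s p nothing         = nothing
contractLbl d r s p (just (var i))  = contractVar d i s p
contractLbl d r s [] (just l)       = just l
contractLbl d r s (j ∷ p) (just l)  = contract (if j ≡ᵇ 0 then suc d else d) (r at (j ∷ [])) s p

stripPrefix : Pos → Pos → Maybe Pos
stripPrefix []      q       = just q
stripPrefix (x ∷ p) []      = nothing
stripPrefix (x ∷ p) (y ∷ q) = if x ≡ᵇ y then stripPrefix p q else nothing

replaceAt : Tm → Pos → Tm → Tm
replaceAt t b u p with stripPrefix b p
... | just q  = u q
... | nothing = t p

Step : Pos → Tm → Tm → Set
Step b t t' =
  t b ≡ just app × t (b ∷ʳ 1) ≡ just lam ×
  (∀ p → t' p ≡ replaceAt t b (contract 0 (t at (b ++ 1 ∷ 0 ∷ [])) (t at (b ∷ʳ 2))) p)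

StronglyConverging : (ℕ → Pos) → Set
StronglyConverging b = ∀ m → Eventually (λ n → m ≤ ad (b n))

IsLimitTm : (ℕ → Tm) → Tm → Set
IsLimitTm t t' = ∀ p →
  ((t' p ↓ → Eventually (λ n → t n p ↓)) × (Eventually (λ n → t n p ↓) → t' p ↓)) ×
  (t' p ↓ → Eventually (λ n → t n p ≡ t' p))

data TyLbl : Set where
  tvar  : ℕ → TyLbl
  arrow : TyLbl

RawTy : Set
RawTy = Pos → Maybe TyLbl

_≈_ : RawTy → RawTy → Set
T ≈ U = ∀ p → T p ≡ U p

TyNode : RawTy → Pos → TyLbl → Set
TyNode T p (tvar _) = ∀ j → T (p ∷ʳ j) ≡ nothing
TyNode T p arrow    = T (p ∷ʳ 0) ≡ nothing × T (p ∷ʳ 1) ↓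

IsType : RawTy → Set
IsType T =
  T [] ↓ × (∀ p j → T (p ∷ʳ j) ↓ → T p ↓) × (∀ p l → T p ≡ just l → TyNode T p l) ×
  (∀ p → ¬ (∀ n → T (p ++ replicate n 1) ↓))

-- sequence types: trees with support ⋃ k·supp(T_k), k ≥ 2
component : RawTy → ℕ → RawTy
component F k q = F (k ∷ q)

IsSeqTy : RawTy → Set
IsSeqTy F =
  F [] ≡ nothing × (∀ q → F (0 ∷ q) ≡ nothing) × (∀ q → F (1 ∷ q) ≡ nothing) ×
  (∀ k → 2 ≤ k → F (k ∷ []) ↓ → IsType (component F k)) ×
  (∀ k q → F (k ∷ []) ≡ nothing → F (k ∷ q) ≡ nothing)

emptySeq : RawTy
emptySeq _ = nothing

single : ℕ → RawTy → RawTy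
single k T []      = nothing
single k T (j ∷ q) = if j ≡ᵇ k then T q else nothing

arr : RawTy → RawTy → RawTy
arr F T []                  = just arrow
arr F T (zero ∷ q)          = nothing
arr F T (suc zero ∷ q)      = T q
arr F T (suc (suc k) ∷ q)   = F (suc (suc k) ∷ q)

dom : RawTy → RawTy
dom T []                = nothing
dom T (zero ∷ q)        = nothing
dom T (suc zero ∷ q)    = nothing
dom T (suc (suc k) ∷ q) = T (suc (suc k) ∷ q)

cod : RawTy → RawTy
cod T q = T (1 ∷ q)

JoinSeq : {I : Set} → (I → RawTy) → RawTy → Set
JoinSeq {I} G E =
  (∀ i i' k → G i (k ∷ []) ↓ → G i' (k ∷ []) ↓ → i ≡ i') ×
  (∀ i k q → G i (k ∷ []) ↓ → E (k ∷ q) ≡ G i (k ∷ q)) ×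
  (∀ k q → (∀ i → G i (k ∷ []) ≡ nothing) → E (k ∷ q) ≡ nothing) ×
  E [] ≡ nothing

Ctx : Set
Ctx = ℕ → RawTy

emptyCtx : Ctx
emptyCtx _ = emptySeq

_≈ᶜ_ : Ctx → Ctx → Set
C ≈ᶜ D = ∀ x → C x ≈ D x

IsCtx : Ctx → Set
IsCtx C = ∀ x → IsSeqTy (C x)

JoinCtx : {I : Set} → (I → Ctx) → Ctx → Set
JoinCtx G E = ∀ x → JoinSeq (λ i → G i x) (E x)

-- Derivations as labelled trees: label at a is (C(a), T(a));
-- the subject at a is t|_{collapse a}

Label : Set
Label = Ctx × RawTy

DTree : Set
DTree = Pos → Maybe Label

ctxAt : Maybe Label → Ctx
ctxAt nothing        = emptyCtx
ctxAt (just (C , _)) = C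

LabelEq : Maybe Label → Maybe Label → Set
LabelEq nothing         nothing           = ⊤
LabelEq nothing         (just _)          = ⊥
LabelEq (just _)        nothing           = ⊥
LabelEq (just (C , T))  (just (C' , T'))  = C ≈ᶜ C' × T ≈ T'

-- contexts of the premises of an (app) node at a: left premise, track k+2 premises
appFamily : Ctx → DTree → Pos → Maybe ℕ → Ctx
appFamily C1 P a nothing  = C1
appFamily C1 P a (just k) = ctxAt (P (a ∷ʳ (2 + k)))

RuleAt : DTree → Pos → Ctx → RawTy → Maybe TmLbl → Set
RuleAt P a C T nothing = ⊥
RuleAt P a C T (just (var i)) =
  (∃ λ k → 2 ≤ k × C i ≈ single k T) × (∀ y → y ≢ i → C y ≈ emptySeq) ×
  (∀ j → P (a ∷ʳ j) ≡ nothing)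
RuleAt P a C T (just lam) =
  (∀ j → j ≢ 0 → P (a ∷ʳ j) ≡ nothing) ×
  ∃₂ λ C0 T0 → P (a ∷ʳ 0) ≡ just (C0 , T0) × T ≈ arr (C0 0) T0 × (∀ y → C y ≈ C0 (suc y))
RuleAt P a C T (just app) =
  P (a ∷ʳ 0) ≡ nothing ×
  ∃₂ λ C1 T1 → P (a ∷ʳ 1) ≡ just (C1 , T1) × T1 [] ≡ just arrow × cod T1 ≈ T ×
    (∀ k → 2 ≤ k →
       (dom T1 (k ∷ []) ↓ → ∃₂ λ D S → P (a ∷ʳ k) ≡ just (D , S) × S ≈ component (dom T1) k) ×
       (dom T1 (k ∷ []) ≡ nothing → P (a ∷ʳ k) ≡ nothing)) ×
    JoinCtx (appFamily C1 P a) C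

IsDerivation : Tm → DTree → Set
IsDerivation t P =
  P [] ↓ × (∀ a j → P (a ∷ʳ j) ↓ → P a ↓) ×
  (∀ a C T → P a ≡ just (C , T) → IsCtx C × IsType T × RuleAt P a C T (t (collapse a)))

-- Quantitativity.  For a' = a ++ q an axiom for the occurrence of x
-- (de Bruijn index x + zeros q there), tr(a')·T(a') is the axiom's
-- context entry C(a')(x + zeros q).

axEntry : Maybe Label → Maybe TmLbl → ℕ → RawTy
axEntry (just (C , T)) (just (var i)) n = if i ≡ᵇ n then C i else emptySeq
axEntry _ _ _ = emptySeq

IsQuantitative : Tm → DTree → Set
IsQuantitative t P = ∀ a C T → P a ≡ just (C , T) → ∀ x →
  JoinSeq (λ q → axEntry (P (a ++ q)) (t (collapse (a ++ q))) (x + zeros q)) (C x)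

removeAt : ℕ → Ctx → Ctx
removeAt d C i = if i <ᵇ d then C i else C (suc i)

shiftCtxAt : ℕ → ℕ → Ctx → Ctx
shiftCtxAt e d C i = if i <ᵇ e then C i else (if i <ᵇ e + d then emptySeq else C (i ∸ d))

shiftLabel : ℕ → ℕ → Maybe Label → Maybe Label
shiftLabel e d nothing        = nothing
shiftLabel e d (just (C , T)) = just (shiftCtxAt e d C , T)

-- a·10·ak is an axiom leaf of P_r for the bound variable x with track k
IsXLeaf : Tm → DTree → Pos → Pos → ℕ → Set
IsXLeaf t P a ak k = ∃₂ λ C T →
  P (a ++ 1 ∷ 0 ∷ ak) ≡ just (C , T) ×
  t (collapse (a ++ 1 ∷ 0 ∷ ak)) ≡ just (var (zeros ak)) ×
  C (zeros ak) (k ∷ []) ↓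

-- (C(α) - x) ∪ ⋃_{k ∈ Rt(C(α)(x))} D^a_k   (x = index d)
redexFamily : DTree → Pos → Ctx → ℕ → Maybe ℕ → Ctx
redexFamily P a C d nothing  = removeAt d C
redexFamily P a C d (just k) =
  if is-just (C d (k ∷ [])) then shiftCtxAt 0 d (ctxAt (P (a ∷ʳ k))) else emptyCtx

PrRel : DTree → Pos → Pos → Maybe Label → Maybe Label → Set
PrRel P a β nothing        tgt = tgt ≡ nothing
PrRel P a β (just (C , T)) tgt =
  ∃₂ λ C' T' → tgt ≡ just (C' , T') × T' ≈ T × JoinCtx (redexFamily P a C (zeros β)) C'

IsReduct : Pos → Tm → DTree → DTree → Set
IsReduct b t P P' = ∀ α →
  (¬ (b ≼ collapse α) → LabelEq (P' α) (P α)) ×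
  (∀ a β → α ≡ a ++ β → collapse a ≡ b →
     (∀ ak k γ → β ≡ ak ++ γ → IsXLeaf t P a ak k →
        LabelEq (P' α) (shiftLabel (zeros γ) (zeros ak) (P (a ++ k ∷ γ)))) ×
     ((∀ ak k γ → β ≡ ak ++ γ → ¬ IsXLeaf t P a ak k) →
        PrRel P a β (P (a ++ 1 ∷ 0 ∷ β)) (P' α)))

IsLimitDeriv : (ℕ → DTree) → DTree → Set
IsLimitDeriv P P' = ∀ a →
  ((P' a ↓ → Eventually (λ n → P n a ↓)) × (Eventually (λ n → P n a ↓) → P' a ↓)) ×
  (P' a ↓ → Eventually (λ n → LabelEq (P n a) (P' a)))

-- Each step P n → P (suc n) preserves being a derivation. Away from the redex nothing
-- changes. Inside it, a node of the body P_r keeps its type and receives the context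
-- (C − x) ∪ ⋃ D_k, which is again a join because the function premise and the argument
-- premises of the (app) node at the redex have disjoint contexts; and each axiom for x
-- with track k becomes a copy of the argument premise P_k with its free variables shifted.
-- Strong convergence then gives, for every position a, a stage after which every redex b m
-- has ad (b m) > ad a + 1, hence lies neither above a nor above a child of a, nor above the
-- subject position collapse a. So the labels at a and at its children and the subject at a
-- are eventually constant, and the rule at a in the limit is the rule at a in a late P n.
module Submission where

open import Defs
open import Data.Nat using (ℕ; zero; suc; _≤_; _<_; _+_; _∸_; _≤ᵇ_; _<ᵇ_; _≡ᵇ_; z≤n; s≤s; z<s; _⊔_; _≤′_; ≤′-refl; ≤′-step)
open import Data.Nat.Properties
open import Data.Bool using (true; false; if_then_else_; T)
open import Data.List using ([]; _∷_; _++_; _∷ʳ_)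
open import Data.List.Properties using (++-assoc; map-++; ++-identityʳ; ∷-injective; ∷-injectiveˡ; ∷-injectiveʳ)
open import Data.Maybe using (Maybe; just; nothing)
import Data.Maybe
open import Data.Maybe.Properties using (just-injective; ≡-dec)
open import Data.Product using (_×_; _,_; ∃; ∃₂; proj₁; proj₂)
open import Data.Sum using (_⊎_; inj₁; inj₂)
open import Data.Unit using (tt)
open import Data.Empty using (⊥; ⊥-elim)
open import Relation.Binary.PropositionalEquality hiding (J)
open import Relation.Binary.Definitions using (DecidableEquality)
open import Relation.Nullary using (¬_; Dec; yes; no)
open import Relation.Nullary.Decidable using (decidable-stable; map′)

≡just⇒↓ : ∀ {A : Set} {x : Maybe A} {y : A} → x ≡ just y → x ↓
≡just⇒↓ e e' with trans (sym e) e'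
... | ()

↓⇒just : ∀ {A : Set} (x : Maybe A) → x ↓ → ∃ λ y → x ≡ just y
↓⇒just nothing d = ⊥-elim (d refl)
↓⇒just (just y) d = y , refl

nothing⊎↓ : ∀ {A : Set} (x : Maybe A) → (x ≡ nothing) ⊎ (x ↓)
nothing⊎↓ nothing = inj₁ refl
nothing⊎↓ (just x) = inj₂ (λ ())

_≟ᵗ_ : DecidableEquality TyLbl
tvar m ≟ᵗ tvar n = map′ (cong tvar) (λ { refl → refl }) (m ≟ n)
tvar _ ≟ᵗ arrow = no λ ()
arrow ≟ᵗ tvar _ = no λ ()
arrow ≟ᵗ arrow = yes refl

_≟ᵐ_ : DecidableEquality (Maybe TyLbl)
_≟ᵐ_ = ≡-dec _≟ᵗ_

_≟ᵏ_ : DecidableEquality (Maybe ℕ)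
_≟ᵏ_ = ≡-dec _≟_

T⇒≡ : ∀ {b} → T b → b ≡ true
T⇒≡ {true} _ = refl

¬T⇒≡ : ∀ {b} → ¬ T b → b ≡ false
¬T⇒≡ {false} _ = refl
¬T⇒≡ {true} n = ⊥-elim (n tt)

<ᵇ-view : ∀ m n → (m < n × (m <ᵇ n) ≡ true) ⊎ (n ≤ m × (m <ᵇ n) ≡ false)
<ᵇ-view m n with m <? n
... | yes lt = inj₁ (lt , T⇒≡ (<⇒<ᵇ lt))
... | no nlt = inj₂ (≮⇒≥ nlt , ¬T⇒≡ (λ t → nlt (<ᵇ⇒< m n t)))

≡ᵇ-view : ∀ m n → (m ≡ n × (m ≡ᵇ n) ≡ true) ⊎ (m ≢ n × (m ≡ᵇ n) ≡ false)
≡ᵇ-view m n with m ≟ n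
... | yes e = inj₁ (e , T⇒≡ (≡⇒≡ᵇ m n e))
... | no ne = inj₂ (ne , ¬T⇒≡ (λ t → ne (≡ᵇ⇒≡ m n t)))

≡ᵇ-refl : ∀ n → (n ≡ᵇ n) ≡ true
≡ᵇ-refl n = T⇒≡ (≡⇒≡ᵇ n n refl)

<⇒<ᵇ≡true : ∀ {m n} → m < n → (m <ᵇ n) ≡ true
<⇒<ᵇ≡true lt = T⇒≡ (<⇒<ᵇ lt)

≥⇒<ᵇ≡false : ∀ {m n} → n ≤ m → (m <ᵇ n) ≡ false
≥⇒<ᵇ≡false {m} {n} ge = ¬T⇒≡ (λ t → <⇒≱ (<ᵇ⇒< m n t) ge)

-- lowerIdx d i is the index contractVar gives to a variable i ≢ d; liftIdx d is its inverse, the index read by removeAt d.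
liftIdx : ℕ → ℕ → ℕ
liftIdx d y = if y <ᵇ d then y else suc y

lowerIdx : ℕ → ℕ → ℕ
lowerIdx d i = if i <ᵇ d then i else i ∸ 1

removeAt-liftIdx : ∀ d C y → removeAt d C y ≡ C (liftIdx d y)
removeAt-liftIdx d C y with y <ᵇ d
... | true = refl
... | false = refl

liftIdx-< : ∀ {d y} → y < d → liftIdx d y ≡ y
liftIdx-< lt rewrite <⇒<ᵇ≡true lt = refl

liftIdx-≥ : ∀ {d y} → d ≤ y → liftIdx d y ≡ suc y
liftIdx-≥ ge rewrite ≥⇒<ᵇ≡false ge = refl

lowerIdx-< : ∀ {d i} → i < d → lowerIdx d i ≡ i
lowerIdx-< lt rewrite <⇒<ᵇ≡true lt = refl

lowerIdx-≥ : ∀ {d i} → d ≤ i → lowerIdx d i ≡ i ∸ 1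
lowerIdx-≥ ge rewrite ≥⇒<ᵇ≡false ge = refl

liftIdx-suc : ∀ d y → liftIdx (suc d) (suc y) ≡ suc (liftIdx d y)
liftIdx-suc d y with y <ᵇ d
... | true = refl
... | false = refl

liftIdx≢removed : ∀ d y → liftIdx d y ≢ d
liftIdx≢removed d y with <ᵇ-view y d
... | inj₁ (y<d , _) = λ e → <⇒≢ y<d (trans (sym (liftIdx-< y<d)) e)
... | inj₂ (d≤y , _) = λ e → <⇒≱ (s≤s d≤y) (≤-reflexive (trans (sym (liftIdx-≥ d≤y)) e))

lowerIdx-liftIdx : ∀ d y → lowerIdx d (liftIdx d y) ≡ y
lowerIdx-liftIdx d y with <ᵇ-view y d
... | inj₁ (y<d , _) = trans (cong (lowerIdx d) (liftIdx-< y<d)) (lowerIdx-< y<d)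
... | inj₂ (d≤y , _) = trans (cong (lowerIdx d) (liftIdx-≥ d≤y)) (lowerIdx-≥ (m≤n⇒m≤1+n d≤y))

liftIdx-lowerIdx : ∀ d i → i ≢ d → liftIdx d (lowerIdx d i) ≡ i
liftIdx-lowerIdx d i i≢d with <ᵇ-view i d
... | inj₁ (i<d , _) = trans (cong (liftIdx d) (lowerIdx-< i<d)) (liftIdx-< i<d)
... | inj₂ (d≤i , _) =
  trans (cong (liftIdx d) (lowerIdx-≥ d≤i)) (trans (liftIdx-≥ (∸-monoˡ-≤ 1 d<i)) (m+[n∸m]≡n (<-≤-trans z<s d<i)))
  where
  d<i : d < i
  d<i = ≤∧≢⇒< d≤i (≢-sym i≢d)

liftIdx≢ : ∀ d i y → y ≢ lowerIdx d i → liftIdx d y ≢ i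
liftIdx≢ d i y y≢ e = y≢ (trans (sym (lowerIdx-liftIdx d y)) (cong (lowerIdx d) e))

zeros-++ : ∀ p q → zeros (p ++ q) ≡ zeros p + zeros q
zeros-++ [] q = refl
zeros-++ (zero ∷ p) q = cong suc (zeros-++ p q)
zeros-++ (suc _ ∷ p) q = zeros-++ p q

zeros-∷ʳ-zero : ∀ p → zeros (p ∷ʳ 0) ≡ suc (zeros p)
zeros-∷ʳ-zero p = trans (zeros-++ p (0 ∷ [])) (+-comm (zeros p) 1)

zeros-∷ʳ-suc : ∀ p j → zeros (p ∷ʳ suc j) ≡ zeros p
zeros-∷ʳ-suc p j = trans (zeros-++ p (suc j ∷ [])) (+-identityʳ (zeros p))

zeros-collapse : ∀ p → zeros (collapse p) ≡ zeros p
zeros-collapse [] = refl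
zeros-collapse (zero ∷ p) = cong suc (zeros-collapse p)
zeros-collapse (suc zero ∷ p) = zeros-collapse p
zeros-collapse (suc (suc _) ∷ p) = zeros-collapse p

collapseEntry : ℕ → ℕ
collapseEntry n = if 2 ≤ᵇ n then 2 else n

collapse-++ : ∀ a β → collapse (a ++ β) ≡ collapse a ++ collapse β
collapse-++ a β = map-++ collapseEntry a β

collapseEntry-≥2 : ∀ k → 2 ≤ k → collapseEntry k ≡ 2
collapseEntry-≥2 (suc (suc k)) _ = refl
collapseEntry-≥2 zero ()
collapseEntry-≥2 (suc zero) (s≤s ())

ad-++ : ∀ p q → ad (p ++ q) ≡ ad p + ad q
ad-++ [] q = refl
ad-++ (n ∷ p) q with 2 ≤ᵇ n
... | true = cong suc (ad-++ p q)
... | false = ad-++ p q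

ad-collapse : ∀ p → ad (collapse p) ≡ ad p
ad-collapse [] = refl
ad-collapse (zero ∷ p) = ad-collapse p
ad-collapse (suc zero ∷ p) = ad-collapse p
ad-collapse (suc (suc m) ∷ p) = cong suc (ad-collapse p)

ad-[_] : ∀ j → ad (j ∷ []) ≤ 1
ad-[ zero ] = z≤n
ad-[ suc zero ] = z≤n
ad-[ suc (suc m) ] = s≤s z≤n

ad-∷ʳ : ∀ a j → ad (a ∷ʳ j) ≤ suc (ad a)
ad-∷ʳ a j = begin
  ad (a ∷ʳ j)         ≡⟨ ad-++ a (j ∷ []) ⟩
  ad a + ad (j ∷ [])  ≤⟨ +-monoʳ-≤ (ad a) ad-[ j ] ⟩
  ad a + 1            ≡⟨ +-comm (ad a) 1 ⟩
  suc (ad a)          ∎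
  where open ≤-Reasoning

ad<⇒¬≼collapse : ∀ (c p : Pos) → ad p < ad c → ¬ (c ≼ collapse p)
ad<⇒¬≼collapse c p lt (r , e) = <⇒≱ lt (begin
  ad c               ≤⟨ m≤m+n (ad c) (ad r) ⟩
  ad c + ad r        ≡⟨ ad-++ c r ⟨
  ad (c ++ r)        ≡⟨ cong ad e ⟩
  ad (collapse p)    ≡⟨ ad-collapse p ⟩
  ad p               ∎)
  where open ≤-Reasoning

stripPrefix-++ : ∀ b q → stripPrefix b (b ++ q) ≡ just q
stripPrefix-++ [] q = refl
stripPrefix-++ (x ∷ b) q rewrite ≡ᵇ-refl x = stripPrefix-++ b q

stripPrefix-just : ∀ b p q → stripPrefix b p ≡ just q → p ≡ b ++ q
stripPrefix-just [] p q refl = refl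
stripPrefix-just (x ∷ b) [] q ()
stripPrefix-just (x ∷ b) (y ∷ p) q e with ≡ᵇ-view x y
... | inj₁ (refl , eq) rewrite eq = cong (x ∷_) (stripPrefix-just b p q e)
... | inj₂ (_ , eq) rewrite eq with e
...   | ()

replaceAt-inside : ∀ t b u q → replaceAt t b u (b ++ q) ≡ u q
replaceAt-inside t b u q rewrite stripPrefix-++ b q = refl

replaceAt-outside : ∀ t b u p → ¬ (b ≼ p) → replaceAt t b u p ≡ t p
replaceAt-outside t b u p nb with stripPrefix b p in eq
... | just q = ⊥-elim (nb (q , sym (stripPrefix-just b p q eq)))
... | nothing = refl

_≼collapse?_ : ∀ (b α : Pos) → (∃₂ λ a β → α ≡ a ++ β × collapse a ≡ b) ⊎ ¬ (b ≼ collapse α)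
[] ≼collapse? α = inj₁ ([] , α , refl , refl)
(x ∷ b') ≼collapse? [] = inj₂ λ { (r , ()) }
(x ∷ b') ≼collapse? (j ∷ α) with collapseEntry j ≟ x
... | no ne = inj₂ λ { (r , e) → ne (sym (proj₁ (∷-injective e))) }
... | yes refl with b' ≼collapse? α
...   | inj₁ (a , β , e , ca) = inj₁ (j ∷ a , β , cong (j ∷_) e , cong (collapseEntry j ∷_) ca)
...   | inj₂ nb = inj₂ λ { (r , e) → nb (r , proj₂ (∷-injective e)) }

≼-collapse-++ : ∀ {b} a β → collapse a ≡ b → b ≼ collapse (a ++ β)
≼-collapse-++ a β ca = collapse β , trans (cong (_++ collapse β) (sym ca)) (sym (collapse-++ a β))

++-∷-nonempty : ∀ (a β : Pos) x → ¬ (a ++ x ∷ β ≡ [])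
++-∷-nonempty [] β x ()
++-∷-nonempty (_ ∷ _) β x ()

++-≡-∷ʳ : ∀ (a β α : Pos) j → a ++ β ≡ α ∷ʳ j →
  (β ≡ [] × a ≡ α ∷ʳ j) ⊎ (∃ λ β' → β ≡ β' ∷ʳ j × a ++ β' ≡ α)
++-≡-∷ʳ a [] α j e = inj₁ (refl , trans (sym (++-identityʳ a)) e)
++-≡-∷ʳ [] (x ∷ β) α j e = inj₂ (α , e , refl)
++-≡-∷ʳ (y ∷ a) (x ∷ β) [] j e = ⊥-elim (++-∷-nonempty a β x (∷-injectiveʳ e))
++-≡-∷ʳ (y ∷ a) (x ∷ β) (z ∷ α) j e with ++-≡-∷ʳ a (x ∷ β) α j (∷-injectiveʳ e)
... | inj₁ (() , _)
... | inj₂ (β' , eβ , ea) = inj₂ (β' , eβ , cong₂ _∷_ (∷-injectiveˡ e) ea)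

prefix-search : ∀ (R : Pos → Set) → (∀ p → Dec (R p)) → ∀ β →
  (∃₂ λ ak γ → β ≡ ak ++ γ × R ak) ⊎ (∀ ak γ → β ≡ ak ++ γ → ¬ R ak)
prefix-search R dR [] with dR []
... | yes r = inj₁ ([] , [] , refl , r)
... | no nr = inj₂ λ { [] γ e → nr ; (x ∷ ak) γ () }
prefix-search R dR (j ∷ β) with dR []
... | yes r = inj₁ ([] , j ∷ β , refl , r)
... | no nr with prefix-search (λ p → R (j ∷ p)) (λ p → dR (j ∷ p)) β
...   | inj₁ (ak , γ , e , r) = inj₁ (j ∷ ak , γ , cong (j ∷_) e , r)
...   | inj₂ n = inj₂ λ { [] γ e → nr ; (x ∷ ak) γ e r → n ak γ (∷-injectiveʳ e) (subst (λ z → R (z ∷ ak)) (sym (∷-injectiveˡ e)) r) }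

≈-refl : ∀ {T} → T ≈ T
≈-refl p = refl

≈-sym : ∀ {T U} → T ≈ U → U ≈ T
≈-sym e p = sym (e p)

≈-trans : ∀ {T U V} → T ≈ U → U ≈ V → T ≈ V
≈-trans e e' p = trans (e p) (e' p)

≈ᶜ-refl : ∀ {C} → C ≈ᶜ C
≈ᶜ-refl x p = refl

≈ᶜ-sym : ∀ {C D} → C ≈ᶜ D → D ≈ᶜ C
≈ᶜ-sym e x = ≈-sym (e x)

≈ᶜ-trans : ∀ {C D E} → C ≈ᶜ D → D ≈ᶜ E → C ≈ᶜ E
≈ᶜ-trans e e' x = ≈-trans (e x) (e' x)

_⊑_ : RawTy → RawTy → Set
F ⊑ G = ∀ k q → F (k ∷ []) ↓ → G (k ∷ q) ≡ F (k ∷ q)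

⊑-trans : ∀ {F G H} → F ⊑ G → G ⊑ H → F ⊑ H
⊑-trans {F} {G} {H} fg gh k q d =
  trans (gh k q (λ e → d (trans (sym (fg k [] d)) e))) (fg k q d)

⊑-refl : ∀ {F} → F ⊑ F
⊑-refl k q d = refl

≈⇒⊑ : ∀ {F G} → F ≈ G → F ⊑ G
≈⇒⊑ e k q _ = sym (e (k ∷ q))

⊑-↓ : ∀ {F G} → F ⊑ G → ∀ k → F (k ∷ []) ↓ → G (k ∷ []) ↓
⊑-↓ {F} {G} s k d z = d (trans (sym (s k [] d)) z)

single-track : ∀ k0 T k → single k0 T (k ∷ []) ↓ → k ≡ k0
single-track k0 T k d with ≡ᵇ-view k k0
... | inj₁ (e , _) = e
... | inj₂ (_ , eq) rewrite eq = ⊥-elim (d refl)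

single-hit : ∀ k T q → single k T (k ∷ q) ≡ T q
single-hit k T q rewrite ≡ᵇ-refl k = refl

single-cong : ∀ k {T T'} → T ≈ T' → single k T ≈ single k T'
single-cong k e [] = refl
single-cong k e (j ∷ q) with j ≡ᵇ k
... | true = e q
... | false = refl

arr-cong : ∀ {F F' T T'} → F ≈ F' → T ≈ T' → arr F T ≈ arr F' T'
arr-cong ef et [] = refl
arr-cong ef et (zero ∷ q) = refl
arr-cong ef et (suc zero ∷ q) = et q
arr-cong ef et (suc (suc k) ∷ q) = ef _

dom-cong : ∀ {T T'} → T ≈ T' → dom T ≈ dom T'
dom-cong e [] = refl
dom-cong e (zero ∷ q) = refl
dom-cong e (suc zero ∷ q) = refl
dom-cong e (suc (suc k) ∷ q) = e _

IsType-cong : ∀ {T U} → T ≈ U → IsType T → IsType U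
IsType-cong {T} {U} e (r , cl , nd , ni) =
  (λ z → r (trans (e []) z)) ,
  (λ p j d z → cl p j (λ z' → d (trans (sym (e (p ∷ʳ j))) z')) (trans (e p) z)) ,
  nd' ,
  (λ p h → ni p (λ n z → h n (trans (sym (e _)) z)))
  where
  nd' : ∀ p l → U p ≡ just l → TyNode U p l
  nd' p (tvar n) z j = trans (sym (e (p ∷ʳ j))) (nd p (tvar n) (trans (e p) z) j)
  nd' p arrow z with nd p arrow (trans (e p) z)
  ... | a , b = trans (sym (e (p ∷ʳ 0))) a , (λ z' → b (trans (e (p ∷ʳ 1)) z'))

-- The index set of a join need not be searchable, so facts about the member contributing a
-- given track are only available under double negation; IsType and label equalities are stable.
IsType-stable : ∀ {T} → ¬ ¬ IsType T → IsType T
IsType-stable {T} nn =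
  (λ z → nn (λ it → proj₁ it z)) ,
  (λ p j d z → nn (λ it → proj₁ (proj₂ it) p j d z)) ,
  nd ,
  (λ p h → nn (λ it → proj₂ (proj₂ (proj₂ it)) p h))
  where
  nd : ∀ p l → T p ≡ just l → TyNode T p l
  nd p (tvar n) z j = decidable-stable (_ ≟ᵐ _) (λ ne → nn (λ it → ne (proj₁ (proj₂ (proj₂ it)) p (tvar n) z j)))
  nd p arrow z = decidable-stable (_ ≟ᵐ _) (λ ne → nn (λ it → ne (proj₁ (proj₁ (proj₂ (proj₂ it)) p arrow z)))) ,
                 (λ z' → nn (λ it → proj₂ (proj₁ (proj₂ (proj₂ it)) p arrow z) z'))

IsSeqTy-cong : ∀ {F F'} → F ≈ F' → IsSeqTy F → IsSeqTy F'
IsSeqTy-cong e (r , z0 , z1 , ty , cl) =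
  trans (sym (e [])) r , (λ q → trans (sym (e _)) (z0 q)) , (λ q → trans (sym (e _)) (z1 q)) ,
  (λ k le d → IsType-cong (λ q → e (k ∷ q)) (ty k le (λ z → d (trans (sym (e _)) z)))) ,
  (λ k q z → trans (sym (e _)) (cl k q (trans (e _) z)))

IsCtx-cong : ∀ {C C'} → C ≈ᶜ C' → IsCtx C → IsCtx C'
IsCtx-cong e ic x = IsSeqTy-cong (e x) (ic x)

emptySeq-isSeqTy : IsSeqTy emptySeq
emptySeq-isSeqTy = refl , (λ _ → refl) , (λ _ → refl) , (λ k _ d → ⊥-elim (d refl)) , (λ _ _ _ → refl)

emptyCtx-isCtx : IsCtx emptyCtx
emptyCtx-isCtx _ = emptySeq-isSeqTy

module _ {I : Set} {G : I → RawTy} {E : RawTy} (J : JoinSeq G E) where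
  join-disjoint : ∀ i i' k → G i (k ∷ []) ↓ → G i' (k ∷ []) ↓ → i ≡ i'
  join-disjoint = proj₁ J
  join-copy : ∀ i k q → G i (k ∷ []) ↓ → E (k ∷ q) ≡ G i (k ∷ q)
  join-copy = proj₁ (proj₂ J)
  join-outside : ∀ k q → (∀ i → G i (k ∷ []) ≡ nothing) → E (k ∷ q) ≡ nothing
  join-outside = proj₁ (proj₂ (proj₂ J))
  join-root : E [] ≡ nothing
  join-root = proj₂ (proj₂ (proj₂ J))
  join-⊑ : ∀ i → G i ⊑ E
  join-⊑ i k q d = join-copy i k q d

join-≈ : ∀ {I I' : Set} {G : I → RawTy} {G' : I' → RawTy} {E E' : RawTy} →
  JoinSeq G E → JoinSeq G' E' →
  (∀ i k → G i (k ∷ []) ↓ → ∃ λ i' → ∀ q → G' i' (k ∷ q) ≡ G i (k ∷ q)) →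
  (∀ i' k → G' i' (k ∷ []) ↓ → ∃ λ i → ∀ q → G i (k ∷ q) ≡ G' i' (k ∷ q)) →
  E ≈ E'
join-≈ {G = G} {G'} {E} {E'} J J' f g [] = trans (join-root {G = G} {E} J) (sym (join-root {G = G'} {E'} J'))
join-≈ {G = G} {G'} {E} {E'} J J' f g (k ∷ q) with E (k ∷ q) ≟ᵐ E' (k ∷ q)
... | yes eq = eq
... | no ne = ⊥-elim (ne (trans (join-outside {G = G} {E} J k q allG) (sym (join-outside {G = G'} {E'} J' k q allG'))))
  where
  allG : ∀ i → G i (k ∷ []) ≡ nothing
  allG i with nothing⊎↓ (G i (k ∷ []))
  ... | inj₁ e = e
  ... | inj₂ d with f i k d
  ...   | i' , h = ⊥-elim (ne (trans (join-copy {G = G} {E} J i k q d)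
                   (trans (sym (h q)) (sym (join-copy {G = G'} {E'} J' i' k q (λ e → d (trans (sym (h [])) e)))))))
  allG' : ∀ i → G' i (k ∷ []) ≡ nothing
  allG' i' with nothing⊎↓ (G' i' (k ∷ []))
  ... | inj₁ e = e
  ... | inj₂ d with g i' k d
  ...   | i , h = ⊥-elim (ne (trans (join-copy {G = G} {E} J i k q (λ e → d (trans (sym (h [])) e)))
                   (trans (h q) (sym (join-copy {G = G'} {E'} J' i' k q d)))))

join-single : ∀ {I : Set} {G : I → RawTy} {X : RawTy} (i0 : I) → (∀ i → Dec (i ≡ i0)) →
  (∀ i → ¬ i ≡ i0 → ∀ k → G i (k ∷ []) ≡ nothing) →
  G i0 ≈ X → X [] ≡ nothing → (∀ k q → X (k ∷ []) ≡ nothing → X (k ∷ q) ≡ nothing) → JoinSeq G X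
join-single {G = G} {X} i0 dec oth eq r0 cl = disj , cp , nn , r0
  where
  isI0 : ∀ i k → G i (k ∷ []) ↓ → i ≡ i0
  isI0 i k d with dec i
  ... | yes e = e
  ... | no ne = ⊥-elim (d (oth i ne k))
  disj : ∀ i i' k → G i (k ∷ []) ↓ → G i' (k ∷ []) ↓ → i ≡ i'
  disj i i' k d d' = trans (isI0 i k d) (sym (isI0 i' k d'))
  cp : ∀ i k q → G i (k ∷ []) ↓ → X (k ∷ q) ≡ G i (k ∷ q)
  cp i k q d with isI0 i k d
  ... | refl = sym (eq (k ∷ q))
  nn : ∀ k q → (∀ i → G i (k ∷ []) ≡ nothing) → X (k ∷ q) ≡ nothing
  nn k q all = cl k q (trans (sym (eq (k ∷ []))) (all i0))

join-empty : ∀ {I : Set} {G : I → RawTy} → (∀ i k → G i (k ∷ []) ≡ nothing) → JoinSeq G emptySeq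
join-empty all = (λ i i' k d _ → ⊥-elim (d (all i k))) , (λ i k q d → ⊥-elim (d (all i k))) ,
                 (λ _ _ _ → refl) , refl

join-cong : ∀ {I : Set} {G G' : I → RawTy} {E E' : RawTy} → (∀ i → G i ≈ G' i) → E ≈ E' →
  JoinSeq G E → JoinSeq G' E'
join-cong {G = G} {G'} {E} {E'} eg ee J =
  (λ i i' k d d' → join-disjoint {G = G} {E} J i i' k (λ e → d (trans (sym (eg i (k ∷ []))) e))
                                  (λ e → d' (trans (sym (eg i' (k ∷ []))) e))) ,
  (λ i k q d → trans (sym (ee (k ∷ q))) (trans (join-copy {G = G} {E} J i k q (λ e → d (trans (sym (eg i (k ∷ []))) e))) (eg i (k ∷ q)))) ,
  (λ k q all → trans (sym (ee (k ∷ q))) (join-outside {G = G} {E} J k q (λ i → trans (eg i (k ∷ [])) (all i)))) ,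
  trans (sym (ee [])) (join-root {G = G} {E} J)

joinCtx-cong : ∀ {I : Set} {G G' : I → Ctx} {E E' : Ctx} → (∀ i → G i ≈ᶜ G' i) → E ≈ᶜ E' →
  JoinCtx G E → JoinCtx G' E'
joinCtx-cong {G = G} {G'} {E} {E'} eg ee J x = join-cong {G = λ i → G i x} {λ i → G' i x} {E x} {E' x} (λ i → eg i x) (ee x) (J x)

join-unique : ∀ {I : Set} {G : I → RawTy} {E E' : RawTy} → JoinSeq G E → JoinSeq G E' → E ≈ E'
join-unique {G = G} {E} {E'} J J' = join-≈ {G = G} {G} {E} {E'} J J' (λ i k _ → i , λ q → refl) (λ i k _ → i , λ q → refl)

join-flatten : ∀ {I J : Set} → (∀ (i i' : I) → Dec (i ≡ i')) → (H : I → J → RawTy) (N : I → RawTy) (E : RawTy) →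
  (∀ i → JoinSeq (H i) (N i)) →
  (∀ i j i' j' k → H i j (k ∷ []) ↓ → H i' j' (k ∷ []) ↓ → i ≡ i') →
  (∀ i j → H i j ⊑ E) →
  (∀ k → (∀ i j → H i j (k ∷ []) ≡ nothing) → ∀ q → E (k ∷ q) ≡ nothing) →
  E [] ≡ nothing → JoinSeq N E
join-flatten {I} {J} deq H N E JH fd sub cov r = disj , cp , nn , r
  where
  allH : ∀ i k → N i (k ∷ []) ↓ → ¬ ¬ (∃ λ j → H i j (k ∷ []) ↓)
  allH i k d nex = d (join-outside {G = H i} {N i} (JH i) k [] λ j → h j)
    where h : ∀ j → H i j (k ∷ []) ≡ nothing
          h j with nothing⊎↓ (H i j (k ∷ []))
          ... | inj₁ z = z
          ... | inj₂ dd = ⊥-elim (nex (j , dd))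
  disj : ∀ i i' k → N i (k ∷ []) ↓ → N i' (k ∷ []) ↓ → i ≡ i'
  disj i i' k d d' = decidable-stable (deq i i') λ ne →
    allH i k d λ { (j , hj) → allH i' k d' λ { (j' , hj') → ne (fd i j i' j' k hj hj') } }
  cp : ∀ i k q → N i (k ∷ []) ↓ → E (k ∷ q) ≡ N i (k ∷ q)
  cp i k q d = decidable-stable (_ ≟ᵐ _) λ ne →
    allH i k d λ { (j , hj) → ne (trans (sub i j k q hj) (sym (join-copy {G = H i} {N i} (JH i) j k q hj))) }
  nn : ∀ k q → (∀ i → N i (k ∷ []) ≡ nothing) → E (k ∷ q) ≡ nothing
  nn k q all = cov k (λ i j → h i j) q
    where h : ∀ i j → H i j (k ∷ []) ≡ nothing
          h i j with nothing⊎↓ (H i j (k ∷ []))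
          ... | inj₁ z = z
          ... | inj₂ dd = ⊥-elim (dd (trans (sym (join-copy {G = H i} {N i} (JH i) j k [] dd)) (all i)))

join-isSeqTy : ∀ {I : Set} {G : I → RawTy} {E : RawTy} → JoinSeq G E → (∀ i → IsSeqTy (G i)) → IsSeqTy E
join-isSeqTy {G = G} {E} J st =
  join-root {G = G} {E} J ,
  (λ q → join-outside {G = G} {E} J 0 q (λ i → proj₁ (proj₂ (st i)) [])) ,
  (λ q → join-outside {G = G} {E} J 1 q (λ i → proj₁ (proj₂ (proj₂ (st i))) [])) ,
  ty , cl
  where
  ty : ∀ k → 2 ≤ k → E (k ∷ []) ↓ → IsType (component E k)
  ty k le d = IsType-stable λ nt → d (join-outside {G = G} {E} J k [] (λ i → all i nt))
    where
    all : ∀ i → ¬ IsType (component E k) → G i (k ∷ []) ≡ nothing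
    all i nt with nothing⊎↓ (G i (k ∷ []))
    ... | inj₁ z = z
    ... | inj₂ di = ⊥-elim (nt (IsType-cong (λ q → sym (join-copy {G = G} {E} J i k q di))
                                  (proj₁ (proj₂ (proj₂ (proj₂ (st i)))) k le di)))
  cl : ∀ k q → E (k ∷ []) ≡ nothing → E (k ∷ q) ≡ nothing
  cl k q z = join-outside {G = G} {E} J k q all
    where
    all : ∀ i → G i (k ∷ []) ≡ nothing
    all i with nothing⊎↓ (G i (k ∷ []))
    ... | inj₁ z' = z'
    ... | inj₂ di = ⊥-elim (di (trans (sym (join-copy {G = G} {E} J i k [] di)) z))

joinCtx-isCtx : ∀ {I : Set} {G : I → Ctx} {E : Ctx} → JoinCtx G E → (∀ i → IsCtx (G i)) → IsCtx E
joinCtx-isCtx {G = G} {E} J st x = join-isSeqTy {G = λ i → G i x} {E x} (J x) (λ i → st i x)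

shiftCtxAt-isCtx : ∀ e d C → IsCtx C → IsCtx (shiftCtxAt e d C)
shiftCtxAt-isCtx e d C ic i with i <ᵇ e
... | true = ic i
... | false with i <ᵇ e + d
...   | true = emptySeq-isSeqTy
...   | false = ic (i ∸ d)

removeAt-isCtx : ∀ d C → IsCtx C → IsCtx (removeAt d C)
removeAt-isCtx d C ic i with i <ᵇ d
... | true = ic i
... | false = ic (suc i)

shiftCtxAt-empty : ∀ e d → shiftCtxAt e d emptyCtx ≈ᶜ emptyCtx
shiftCtxAt-empty e d i p with i <ᵇ e
... | true = refl
... | false with i <ᵇ e + d
...   | true = refl
...   | false = refl

ctxAt-shiftLabel : ∀ e d x → ctxAt (shiftLabel e d x) ≈ᶜ shiftCtxAt e d (ctxAt x)
ctxAt-shiftLabel e d nothing = ≈ᶜ-sym (shiftCtxAt-empty e d)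
ctxAt-shiftLabel e d (just (C , T)) = ≈ᶜ-refl

shiftCtxAt-join : ∀ {I : Set} e d {G : I → Ctx} {E : Ctx} → JoinCtx G E →
  JoinCtx (λ i → shiftCtxAt e d (G i)) (shiftCtxAt e d E)
shiftCtxAt-join e d J y with y <ᵇ e
... | true = J y
... | false with y <ᵇ e + d
...   | true = join-empty {G = λ _ _ → nothing} (λ i k → refl)
...   | false = J (y ∸ d)

shiftCtxAt-suc : ∀ e d {C C0 : Ctx} → (∀ y → C y ≈ C0 (suc y)) →
  ∀ y → shiftCtxAt e d C y ≈ shiftCtxAt (suc e) d C0 (suc y)
shiftCtxAt-suc e d {C} {C0} h y with <ᵇ-view y e
... | inj₁ (_ , eq) rewrite eq = h y
... | inj₂ (le , eq) rewrite eq with <ᵇ-view y (e + d)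
...   | inj₁ (_ , eq2) rewrite eq2 = ≈-refl
...   | inj₂ (le2 , eq2) rewrite eq2 = λ p → trans (h (y ∸ d) p) (cong (λ z → C0 z p) (sym (+-∸-assoc 1 (≤-trans (m≤n+m d e) le2))))

shiftCtxAt-bound : ∀ e d C i → i < e → shiftCtxAt e d C i ≈ C i
shiftCtxAt-bound e d C i lt with <ᵇ-view i e
... | inj₁ (_ , eq) rewrite eq = ≈-refl
... | inj₂ (le , _) = ⊥-elim (<-irrefl refl (<-≤-trans lt le))

shiftCtxAt-free : ∀ e d C i → e ≤ i → shiftCtxAt e d C (i + d) ≈ C i
shiftCtxAt-free e d C i le with <ᵇ-view (i + d) e
... | inj₁ (lt , _) = ⊥-elim (<-irrefl refl (<-≤-trans lt (≤-trans le (m≤m+n i d))))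
... | inj₂ (_ , eq) rewrite eq with <ᵇ-view (i + d) (e + d)
...   | inj₁ (lt , _) = ⊥-elim (<-irrefl refl (<-≤-trans lt (+-monoˡ-≤ d le)))
...   | inj₂ (_ , eq2) rewrite eq2 | m+n∸n≡m i d = ≈-refl

shiftCtxAt-others-bound : ∀ e d C i → i < e → (∀ y → y ≢ i → C y ≈ emptySeq) →
  ∀ y → y ≢ i → shiftCtxAt e d C y ≈ emptySeq
shiftCtxAt-others-bound e d C i ie oth y ne with <ᵇ-view y e
... | inj₁ (_ , eq) rewrite eq = oth y ne
... | inj₂ (ey , eq) rewrite eq with <ᵇ-view y (e + d)
...   | inj₁ (_ , eq2) rewrite eq2 = ≈-refl
...   | inj₂ (le2 , eq2) rewrite eq2 = oth (y ∸ d) (λ z → <-irrefl (sym z) (<-≤-trans ie (m+n≤o⇒m≤o∸n e le2)))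

shiftCtxAt-others-free : ∀ e d C i → e ≤ i → (∀ y → y ≢ i → C y ≈ emptySeq) →
  ∀ y → y ≢ i + d → shiftCtxAt e d C y ≈ emptySeq
shiftCtxAt-others-free e d C i ie oth y ne with <ᵇ-view y e
... | inj₁ (ye , eq) rewrite eq = oth y (λ z → <-irrefl z (<-≤-trans ye ie))
... | inj₂ (ey , eq) rewrite eq with <ᵇ-view y (e + d)
...   | inj₁ (_ , eq2) rewrite eq2 = ≈-refl
...   | inj₂ (le2 , eq2) rewrite eq2 =
        oth (y ∸ d) (λ z → ne (trans (sym (m∸n+n≡m (≤-trans (m≤n+m d e) le2))) (cong (_+ d) z)))

shiftCtxAt0-< : ∀ {d y} X → y < d → shiftCtxAt 0 d X y ≡ emptySeq
shiftCtxAt0-< X lt rewrite <⇒<ᵇ≡true lt = refl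

shiftCtxAt0-≥ : ∀ {d y} X → d ≤ y → shiftCtxAt 0 d X y ≡ X (y ∸ d)
shiftCtxAt0-≥ X ge rewrite ≥⇒<ᵇ≡false ge = refl

LabelEq-refl : ∀ x → LabelEq x x
LabelEq-refl nothing = tt
LabelEq-refl (just (C , T)) = ≈ᶜ-refl , ≈-refl

LabelEq-sym : ∀ {x y} → LabelEq x y → LabelEq y x
LabelEq-sym {nothing} {nothing} e = tt
LabelEq-sym {just _} {just _} (c , t) = ≈ᶜ-sym c , ≈-sym t

LabelEq-trans : ∀ {x y z} → LabelEq x y → LabelEq y z → LabelEq x z
LabelEq-trans {nothing} {nothing} {nothing} _ _ = tt
LabelEq-trans {just _} {just _} {just _} (c , t) (c' , t') = ≈ᶜ-trans c c' , ≈-trans t t'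

LabelEq-nothingˡ : ∀ {x y} → LabelEq x y → x ≡ nothing → y ≡ nothing
LabelEq-nothingˡ {nothing} {nothing} _ _ = refl

LabelEq-nothingʳ : ∀ {x y} → LabelEq x y → y ≡ nothing → x ≡ nothing
LabelEq-nothingʳ {nothing} {nothing} _ _ = refl

LabelEq-↓ : ∀ {x y} → LabelEq x y → x ↓ → y ↓
LabelEq-↓ {x} {y} e d z = d (LabelEq-nothingʳ {x} {y} e z)

LabelEq-just : ∀ {x y C T} → LabelEq x y → x ≡ just (C , T) →
  ∃₂ λ C' T' → y ≡ just (C' , T') × C ≈ᶜ C' × T ≈ T'
LabelEq-just {just _} {just (C' , T')} (c , t) refl = C' , T' , refl , c , t

LabelEq-ctx : ∀ {x y} → LabelEq x y → ctxAt x ≈ᶜ ctxAt y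
LabelEq-ctx {nothing} {nothing} _ = ≈ᶜ-refl
LabelEq-ctx {just _} {just _} (c , _) = c

LabelEq-≡ : ∀ {x y} → x ≡ y → LabelEq x y
LabelEq-≡ {x} refl = LabelEq-refl x

RuleAt-cong : ∀ {P1 P2 : DTree} {a1 a2 C C' T T'} l →
  (∀ j → LabelEq (P1 (a1 ∷ʳ j)) (P2 (a2 ∷ʳ j))) → C ≈ᶜ C' → T ≈ T' →
  RuleAt P1 a1 C T l → RuleAt P2 a2 C' T' l
RuleAt-cong nothing ch eC eT ()
RuleAt-cong {P1} {P2} {a1} {a2} {C} {C'} {T} {T'} (just (var i)) ch eC eT ((k , le , Ci) , oth , nc) =
  (k , le , ≈-trans (≈-sym (eC i)) (≈-trans Ci (single-cong k eT))) ,
  (λ y ne → ≈-trans (≈-sym (eC y)) (oth y ne)) ,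
  (λ j → LabelEq-nothingˡ {P1 (a1 ∷ʳ j)} {P2 (a2 ∷ʳ j)} (ch j) (nc j))
RuleAt-cong {P1} {P2} {a1} {a2} {C} {C'} {T} {T'} (just lam) ch eC eT (nc , C0 , T0 , e0 , Tarr , Cs)
  with LabelEq-just {P1 (a1 ∷ʳ 0)} {P2 (a2 ∷ʳ 0)} (ch 0) e0
... | C0' , T0' , e0' , c0 , t0 =
  (λ j ne → LabelEq-nothingˡ {P1 (a1 ∷ʳ j)} {P2 (a2 ∷ʳ j)} (ch j) (nc j ne)) ,
  C0' , T0' , e0' , ≈-trans (≈-sym eT) (≈-trans Tarr (arr-cong (c0 0) t0)) ,
  (λ y → ≈-trans (≈-sym (eC y)) (≈-trans (Cs y) (c0 (suc y))))
RuleAt-cong {P1} {P2} {a1} {a2} {C} {C'} {T} {T'} (just app) ch eC eT (n0 , C1 , T1 , e1 , ar , cd , prem , J)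
  with LabelEq-just {P1 (a1 ∷ʳ 1)} {P2 (a2 ∷ʳ 1)} (ch 1) e1
... | C1' , T1' , e1' , c1 , t1 =
  LabelEq-nothingˡ {P1 (a1 ∷ʳ 0)} {P2 (a2 ∷ʳ 0)} (ch 0) n0 ,
  C1' , T1' , e1' , trans (sym (t1 [])) ar ,
  (λ q → trans (sym (t1 (1 ∷ q))) (trans (cd q) (eT q))) ,
  prem' ,
  joinCtx-cong fam eC J
  where
  prem' : ∀ k → 2 ≤ k →
       (dom T1' (k ∷ []) ↓ → ∃₂ λ D S → P2 (a2 ∷ʳ k) ≡ just (D , S) × S ≈ component (dom T1') k) ×
       (dom T1' (k ∷ []) ≡ nothing → P2 (a2 ∷ʳ k) ≡ nothing)
  prem' k le with prem k le
  ... | p1 , p2 =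
    (λ d → let (D , S , eq , sc) = p1 (λ z → d (trans (sym (dom-cong t1 (k ∷ []))) z))
               (D' , S' , eq' , _ , s) = LabelEq-just {P1 (a1 ∷ʳ k)} {P2 (a2 ∷ʳ k)} (ch k) eq
           in D' , S' , eq' , ≈-trans (≈-sym s) (≈-trans sc (λ q → dom-cong t1 (k ∷ q)))) ,
    (λ z → LabelEq-nothingˡ {P1 (a1 ∷ʳ k)} {P2 (a2 ∷ʳ k)} (ch k) (p2 (trans (dom-cong t1 (k ∷ [])) z)))
  fam : ∀ i → appFamily C1 P1 a1 i ≈ᶜ appFamily C1' P2 a2 i
  fam nothing = c1
  fam (just k) = LabelEq-ctx {P1 (a1 ∷ʳ (2 + k))} {P2 (a2 ∷ʳ (2 + k))} (ch (2 + k))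

shiftLabel-↓⁻¹ : ∀ e d x → shiftLabel e d x ↓ → x ↓
shiftLabel-↓⁻¹ e d nothing dd = ⊥-elim (dd refl)
shiftLabel-↓⁻¹ e d (just _) dd = λ ()

shiftLabel-↓ : ∀ e d x → x ↓ → shiftLabel e d x ↓
shiftLabel-↓ e d nothing dd = ⊥-elim (dd refl)
shiftLabel-↓ e d (just _) dd = λ ()

-- An argument derivation placed below d binders: its free variables are shifted by d.
shiftTree : ℕ → DTree → DTree
shiftTree d Q γ = shiftLabel (zeros γ) d (Q γ)

shiftTree-nothing : ∀ d Q p → Q p ≡ nothing → shiftTree d Q p ≡ nothing
shiftTree-nothing d Q p eq rewrite eq = refl

shiftTree-just : ∀ d Q p {C T} → Q p ≡ just (C , T) → shiftTree d Q p ≡ just (shiftCtxAt (zeros p) d C , T)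
shiftTree-just d Q p eq rewrite eq = refl

shiftTree-rule : ∀ d Q γ C T l → RuleAt Q γ C T (just l) →
  RuleAt (shiftTree d Q) γ (shiftCtxAt (zeros γ) d C) T (just (shiftLbl d (zeros γ) l))
shiftTree-rule d Q γ C T (var i) ((k , le , Ci) , oth , nc) with <ᵇ-view i (zeros γ)
... | inj₁ (lt , eq) rewrite eq =
  (k , le , ≈-trans (shiftCtxAt-bound (zeros γ) d C i lt) Ci) ,
  shiftCtxAt-others-bound (zeros γ) d C i lt oth ,
  (λ j → shiftTree-nothing d Q (γ ∷ʳ j) (nc j))
... | inj₂ (ge , eq) rewrite eq =
  (k , le , ≈-trans (shiftCtxAt-free (zeros γ) d C i ge) Ci) ,
  shiftCtxAt-others-free (zeros γ) d C i ge oth ,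
  (λ j → shiftTree-nothing d Q (γ ∷ʳ j) (nc j))
shiftTree-rule d Q γ C T lam (nc , C0 , T0 , e0 , Tarr , Cs) =
  (λ j ne → shiftTree-nothing d Q (γ ∷ʳ j) (nc j ne)) ,
  shiftCtxAt (suc (zeros γ)) d C0 , T0 ,
  trans (shiftTree-just d Q (γ ∷ʳ 0) e0) (cong (λ z → just (shiftCtxAt z d C0 , T0)) (zeros-∷ʳ-zero γ)) ,
  Tarr ,
  shiftCtxAt-suc (zeros γ) d {C} {C0} Cs
shiftTree-rule d Q γ C T app (n0 , C1 , T1 , e1 , ar , cd , prem , J) =
  shiftTree-nothing d Q (γ ∷ʳ 0) n0 ,
  shiftCtxAt (zeros γ) d C1 , T1 ,
  trans (shiftTree-just d Q (γ ∷ʳ 1) e1) (cong (λ z → just (shiftCtxAt z d C1 , T1)) (zeros-∷ʳ-suc γ 0)) ,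
  ar , cd , prem' ,
  joinCtx-cong {E = shiftCtxAt (zeros γ) d C} {E' = shiftCtxAt (zeros γ) d C} fam ≈ᶜ-refl (shiftCtxAt-join (zeros γ) d {G = appFamily C1 Q γ} {E = C} J)
  where
  prem' : ∀ k → 2 ≤ k →
       (dom T1 (k ∷ []) ↓ → ∃₂ λ D S → shiftTree d Q (γ ∷ʳ k) ≡ just (D , S) × S ≈ component (dom T1) k) ×
       (dom T1 (k ∷ []) ≡ nothing → shiftTree d Q (γ ∷ʳ k) ≡ nothing)
  prem' (suc (suc k)) (s≤s (s≤s _)) with prem (suc (suc k)) (s≤s (s≤s z≤n))
  ... | p1 , p2 =
    (λ dd → let (D , S , eq , sc) = p1 dd in
      shiftCtxAt (zeros γ) d D , S ,
      trans (shiftTree-just d Q (γ ∷ʳ suc (suc k)) eq) (cong (λ z → just (shiftCtxAt z d D , S)) (zeros-∷ʳ-suc γ (suc k))) , sc) ,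
    (λ z → shiftTree-nothing d Q _ (p2 z))
  fam : ∀ i → shiftCtxAt (zeros γ) d (appFamily C1 Q γ i) ≈ᶜ appFamily (shiftCtxAt (zeros γ) d C1) (shiftTree d Q) γ i
  fam nothing = ≈ᶜ-refl
  fam (just k) = ≈ᶜ-sym (≈ᶜ-trans (ctxAt-shiftLabel (zeros (γ ∷ʳ suc (suc k))) d (Q (γ ∷ʳ suc (suc k))))
                   (subst (λ z → shiftCtxAt z d (ctxAt (Q (γ ∷ʳ suc (suc k)))) ≈ᶜ shiftCtxAt (zeros γ) d (ctxAt (Q (γ ∷ʳ suc (suc k)))))
                     (sym (zeros-∷ʳ-suc γ (suc k))) ≈ᶜ-refl))

NonLeafPath : Tm → Pos → Set
NonLeafPath r β = ∀ β₀ j β₁ → β ≡ β₀ ++ j ∷ β₁ → (r (collapse β₀) ≡ just lam) ⊎ (r (collapse β₀) ≡ just app)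

contract-∷ : ∀ d (r : Tm) s c p → (r [] ≡ just lam) ⊎ (r [] ≡ just app) →
  contract d r s (c ∷ p) ≡ contract (if c ≡ᵇ 0 then suc d else d) (r at (c ∷ [])) s p
contract-∷ d r s c p (inj₁ e) rewrite e = refl
contract-∷ d r s c p (inj₂ e) rewrite e = refl

contract-along : ∀ (r : Tm) d s β q → NonLeafPath r β → contract d r s (collapse β ++ q) ≡ contract (d + zeros β) (r at collapse β) s q
contract-along r d s [] q nv rewrite +-identityʳ d = refl
contract-along r d s (zero ∷ β) q nv =
  trans (contract-∷ d r s 0 _ (nv [] 0 β refl))
   (trans (contract-along (r at (0 ∷ [])) (suc d) s β q (λ β₀ j' β₁ eq → nv (0 ∷ β₀) j' β₁ (cong (0 ∷_) eq)))
     (cong (λ z → contract z (r at collapse (zero ∷ β)) s q) (sym (+-suc d (zeros β)))))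
contract-along r d s (suc zero ∷ β) q nv =
  trans (contract-∷ d r s 1 _ (nv [] 1 β refl))
   (contract-along (r at (1 ∷ [])) d s β q (λ β₀ j' β₁ eq → nv (1 ∷ β₀) j' β₁ (cong (1 ∷_) eq)))
contract-along r d s (suc (suc m) ∷ β) q nv =
  trans (contract-∷ d r s 2 _ (nv [] (suc (suc m)) β refl))
   (contract-along (r at (2 ∷ [])) d s β q (λ β₀ j' β₁ eq → nv (suc (suc m) ∷ β₀) j' β₁ (cong (suc (suc m) ∷_) eq)))

contractVar-hit : ∀ d s p → contractVar d d s p ≡ shiftTm d s p
contractVar-hit d s p rewrite ≡ᵇ-refl d = refl

contractVar-miss : ∀ d i s → i ≢ d → contractVar d i s [] ≡ just (var (lowerIdx d i))
contractVar-miss d i s ne with ≡ᵇ-view i d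
... | inj₁ (e , _) = ⊥-elim (ne e)
... | inj₂ (_ , eq) rewrite eq = refl

IsSubderivation : Tm → DTree → Set
IsSubderivation s Q =
  (∀ β j → Q (β ∷ʳ j) ↓ → Q β ↓) ×
  (∀ β C T → Q β ≡ just (C , T) → IsCtx C × IsType T × RuleAt Q β C T (s (collapse β)))

module Subderivation {s : Tm} {Q : DTree} (D : IsSubderivation s Q) where

  closed : ∀ β j → Q (β ∷ʳ j) ↓ → Q β ↓
  closed = proj₁ D

  node : ∀ β C T → Q β ≡ just (C , T) → IsCtx C × IsType T × RuleAt Q β C T (s (collapse β))
  node = proj₂ D

  subtree : ∀ c (Q' : DTree) (s' : Tm) → (∀ β → Q (c ++ β) ≡ Q' β) →
    (∀ β → s (collapse (c ++ β)) ≡ s' (collapse β)) → IsSubderivation s' Q'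
  subtree c Q' s' eQ es = closed' , node'
    where
    closed' : ∀ β j → Q' (β ∷ʳ j) ↓ → Q' β ↓
    closed' β j d z = closed (c ++ β) j (λ w → d (trans (sym (eQ (β ∷ʳ j))) (trans (cong Q (sym (++-assoc c β (j ∷ [])))) w)))
                        (trans (eQ β) z)
    node' : ∀ β C T → Q' β ≡ just (C , T) → IsCtx C × IsType T × RuleAt Q' β C T (s' (collapse β))
    node' β C T e with node (c ++ β) C T (trans (eQ β) e)
    ... | ic , it , ru = ic , it ,
       subst (RuleAt Q' β C T) (es β)
         (RuleAt-cong {Q} {Q'} {c ++ β} {β} (s (collapse (c ++ β)))
           (λ j → LabelEq-≡ (trans (cong Q (++-assoc c β (j ∷ []))) (eQ (β ∷ʳ j)))) ≈ᶜ-refl ≈-refl ru)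

  ctxAt-isCtx : ∀ p → IsCtx (ctxAt (Q p))
  ctxAt-isCtx p with Q p in eq
  ... | nothing = emptyCtx-isCtx
  ... | just (D , S) = proj₁ (node p D S eq)

  prefix-↓ : ∀ x y → Q (x ++ y) ↓ → Q x ↓
  prefix-↓ x [] d = λ z → d (trans (cong Q (++-identityʳ x)) z)
  prefix-↓ x (j ∷ y) d = closed x j (prefix-↓ (x ∷ʳ j) y (λ z → d (trans (cong Q (sym (++-assoc x (j ∷ []) y))) z)))

  inner-rule : ∀ β C T j l → RuleAt Q β C T l → Q (β ∷ʳ j) ↓ → (l ≡ just lam) ⊎ (l ≡ just app)
  inner-rule β C T j nothing () d
  inner-rule β C T j (just (var i)) (_ , _ , nc) d = ⊥-elim (d (nc j))
  inner-rule β C T j (just lam) _ d = inj₁ refl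
  inner-rule β C T j (just app) _ d = inj₂ refl

  inner-node : ∀ β C T j → Q β ≡ just (C , T) → Q (β ∷ʳ j) ↓ → (s (collapse β) ≡ just lam) ⊎ (s (collapse β) ≡ just app)
  inner-node β C T j e d = inner-rule β C T j (s (collapse β)) (proj₂ (proj₂ (node β C T e))) d

  path-nonLeaf : ∀ β → Q β ↓ → NonLeafPath s β
  path-nonLeaf β d β₀ j β₁ refl with ↓⇒just (Q β₀) (prefix-↓ β₀ (j ∷ []) (prefix-↓ (β₀ ++ j ∷ []) β₁
                              (λ z → d (trans (cong Q (sym (++-assoc β₀ (j ∷ []) β₁))) z))))
  ... | (C , T) , e = inner-node β₀ C T j e (prefix-↓ (β₀ ∷ʳ j) β₁ (λ z → d (trans (cong Q (sym (++-assoc β₀ (j ∷ []) β₁))) z)))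

  child-ctx-⊑-rule : ∀ γ j Cγ Tγ Cj Tj l → RuleAt Q γ Cγ Tγ l → Q (γ ∷ʳ j) ≡ just (Cj , Tj) →
    ∀ z → Cj (zeros (j ∷ []) + z) ⊑ Cγ z
  child-ctx-⊑-rule γ j Cγ Tγ Cj Tj nothing () e z
  child-ctx-⊑-rule γ j Cγ Tγ Cj Tj (just (var i)) (_ , _ , nc) e z = ⊥-elim (≡just⇒↓ e (nc j))
  child-ctx-⊑-rule γ zero Cγ Tγ Cj Tj (just lam) (nc , C0 , T0 , e0 , _ , Cs) e z
    with just-injective (trans (sym e0) e)
  ... | refl = ≈⇒⊑ {Cj (suc z)} {Cγ z} (≈-sym (Cs z))
  child-ctx-⊑-rule γ (suc j) Cγ Tγ Cj Tj (just lam) (nc , _) e z = ⊥-elim (≡just⇒↓ e (nc (suc j) (λ ())))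
  child-ctx-⊑-rule γ zero Cγ Tγ Cj Tj (just app) (n0 , _) e z = ⊥-elim (≡just⇒↓ e n0)
  child-ctx-⊑-rule γ (suc zero) Cγ Tγ Cj Tj (just app) (n0 , C1 , T1 , e1 , _ , _ , _ , J) e z
    with just-injective (trans (sym e1) e)
  ... | refl = join-⊑ {G = λ i → appFamily C1 Q γ i z} {E = Cγ z} (J z) nothing
  child-ctx-⊑-rule γ (suc (suc m)) Cγ Tγ Cj Tj (just app) (n0 , C1 , T1 , e1 , _ , _ , _ , J) e z =
    subst (λ X → X z ⊑ Cγ z) (cong ctxAt e) (join-⊑ {G = λ i → appFamily C1 Q γ i z} {E = Cγ z} (J z) (just m))

  child-ctx-⊑ : ∀ γ j Cγ Tγ Cj Tj → Q γ ≡ just (Cγ , Tγ) → Q (γ ∷ʳ j) ≡ just (Cj , Tj) →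
    ∀ z → Cj (zeros (j ∷ []) + z) ⊑ Cγ z
  child-ctx-⊑ γ j Cγ Tγ Cj Tj eγ ej = child-ctx-⊑-rule γ j Cγ Tγ Cj Tj _ (proj₂ (proj₂ (node γ Cγ Tγ eγ))) ej

  descendant-ctx-⊑ : ∀ γ β Cγ Tγ C T → Q γ ≡ just (Cγ , Tγ) → Q (γ ++ β) ≡ just (C , T) → ∀ z → C (zeros β + z) ⊑ Cγ z
  descendant-ctx-⊑ γ [] Cγ Tγ C T eγ e z with just-injective (trans (sym e) (trans (cong Q (++-identityʳ γ)) eγ))
  ... | refl = ⊑-refl {Cγ z}
  descendant-ctx-⊑ γ (j ∷ β) Cγ Tγ C T eγ e z
    with ↓⇒just (Q (γ ∷ʳ j)) (prefix-↓ (γ ∷ʳ j) β (λ w → ≡just⇒↓ e (trans (cong Q (sym (++-assoc γ (j ∷ []) β))) w)))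
  ... | (Cj , Tj) , ej =
    subst (λ w → C w ⊑ Cγ z) (zeros-assoc j)
      (⊑-trans {C (zeros β + (zeros (j ∷ []) + z))} {Cj (zeros (j ∷ []) + z)} {Cγ z} (descendant-ctx-⊑ (γ ∷ʳ j) β Cj Tj C T ej (trans (cong Q (++-assoc γ (j ∷ []) β)) e) (zeros (j ∷ []) + z))
               (child-ctx-⊑ γ j Cγ Tγ Cj Tj eγ ej z))
    where
    zeros-assoc : ∀ j → zeros β + (zeros (j ∷ []) + z) ≡ zeros (j ∷ β) + z
    zeros-assoc zero = +-suc (zeros β) z
    zeros-assoc (suc j) = refl

module SubjectReduction (t : Tm) (P : DTree) (b : Pos) (t' : Tm) (P' : DTree)
  (der : IsDerivation t P) (step : Step b t t') (red : IsReduct b t P P') where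

  module PD = Subderivation {t} {P} (proj₂ der)

  redex-app : t b ≡ just app
  redex-app = proj₁ step
  redex-lam : t (b ∷ʳ 1) ≡ just lam
  redex-lam = proj₁ (proj₂ step)
  reduct-subject : ∀ p → t' p ≡ replaceAt t b (contract 0 (t at (b ++ 1 ∷ 0 ∷ [])) (t at (b ∷ʳ 2))) p
  reduct-subject = proj₂ (proj₂ step)

  redexBody : Tm
  redexBody = t at (b ++ 1 ∷ 0 ∷ [])
  redexArg : Tm
  redexArg = t at (b ∷ʳ 2)

  -- The redex b of the term may be typed at many positions a of the derivation (one per track).
  module Redex (a : Pos) (ca : collapse a ≡ b) (Ca : Ctx) (Ta : RawTy) (ePa : P a ≡ just (Ca , Ta)) where

    appRule : RuleAt P a Ca Ta (just app)
    appRule = subst (RuleAt P a Ca Ta) (trans (cong t ca) redex-app) (proj₂ (proj₂ (PD.node a Ca Ta ePa)))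

    C₁ : Ctx
    C₁ = proj₁ (proj₂ appRule)
    T₁ : RawTy
    T₁ = proj₁ (proj₂ (proj₂ appRule))
    P-fun : P (a ∷ʳ 1) ≡ just (C₁ , T₁)
    P-fun = proj₁ (proj₂ (proj₂ (proj₂ appRule)))
    T₁-cod : cod T₁ ≈ Ta
    T₁-cod = proj₁ (proj₂ (proj₂ (proj₂ (proj₂ (proj₂ appRule)))))
    arg-premises : ∀ k → 2 ≤ k →
         (dom T₁ (k ∷ []) ↓ → ∃₂ λ D S → P (a ∷ʳ k) ≡ just (D , S) × S ≈ component (dom T₁) k) ×
         (dom T₁ (k ∷ []) ≡ nothing → P (a ∷ʳ k) ≡ nothing)
    arg-premises = proj₁ (proj₂ (proj₂ (proj₂ (proj₂ (proj₂ (proj₂ appRule))))))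
    ctx-join : JoinCtx (appFamily C₁ P a) Ca
    ctx-join = proj₂ (proj₂ (proj₂ (proj₂ (proj₂ (proj₂ (proj₂ appRule))))))

    absRule : RuleAt P (a ∷ʳ 1) C₁ T₁ (just lam)
    absRule = subst (RuleAt P (a ∷ʳ 1) C₁ T₁)
              (trans (cong t (trans (collapse-++ a (1 ∷ [])) (cong (_++ (1 ∷ [])) ca))) redex-lam)
              (proj₂ (proj₂ (PD.node (a ∷ʳ 1) C₁ T₁ P-fun)))

    C₀ : Ctx
    C₀ = proj₁ (proj₂ absRule)
    T₀ : RawTy
    T₀ = proj₁ (proj₂ (proj₂ absRule))
    T₁-arr : T₁ ≈ arr (C₀ 0) T₀
    T₁-arr = proj₁ (proj₂ (proj₂ (proj₂ (proj₂ absRule))))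
    C₁-C₀ : ∀ y → C₁ y ≈ C₀ (suc y)
    C₁-C₀ = proj₂ (proj₂ (proj₂ (proj₂ (proj₂ absRule))))

    Pbody : DTree
    Pbody β = P (a ++ 1 ∷ 0 ∷ β)

    tbody : Tm
    tbody p = t (b ++ 1 ∷ 0 ∷ p)

    Pbody-root : Pbody [] ≡ just (C₀ , T₀)
    Pbody-root = trans (cong P (sym (++-assoc a (1 ∷ []) (0 ∷ [])))) (proj₁ (proj₂ (proj₂ (proj₂ absRule))))

    tbody-subject : ∀ β → t (collapse ((a ++ 1 ∷ 0 ∷ []) ++ β)) ≡ tbody (collapse β)
    tbody-subject β = cong t (trans (collapse-++ (a ++ 1 ∷ 0 ∷ []) β)
                    (trans (cong (_++ collapse β) (trans (collapse-++ a (1 ∷ 0 ∷ [])) (cong (_++ (1 ∷ 0 ∷ [])) ca)))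
                           (++-assoc b (1 ∷ 0 ∷ []) (collapse β))))

    body-isSubderivation : IsSubderivation tbody Pbody
    body-isSubderivation = PD.subtree (a ++ 1 ∷ 0 ∷ []) Pbody tbody (λ β → cong P (++-assoc a (1 ∷ 0 ∷ []) β)) tbody-subject

    module Body = Subderivation {tbody} {Pbody} body-isSubderivation

    Parg : ℕ → DTree
    Parg k γ = P (a ++ k ∷ γ)

    targ : Tm
    targ p = t (b ++ 2 ∷ p)

    targ-subject : ∀ k → 2 ≤ k → ∀ γ → t (collapse ((a ∷ʳ k) ++ γ)) ≡ targ (collapse γ)
    targ-subject k le γ = cong t (trans (collapse-++ (a ∷ʳ k) γ)
                    (trans (cong (_++ collapse γ) (trans (collapse-++ a (k ∷ []))
                              (cong₂ (λ u v → u ++ v ∷ []) ca (collapseEntry-≥2 k le))))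
                           (++-assoc b (2 ∷ []) (collapse γ))))

    arg-isSubderivation : ∀ k → 2 ≤ k → IsSubderivation targ (Parg k)
    arg-isSubderivation k le = PD.subtree (a ∷ʳ k) (Parg k) targ (λ γ → cong P (++-assoc a (k ∷ []) γ)) (targ-subject k le)

    IsBoundLeaf : Pos → Set
    IsBoundLeaf ak = ∃ λ k → IsXLeaf t P a ak k

    isBoundLeaf? : ∀ ak → Dec (IsBoundLeaf ak)
    isBoundLeaf? ak with P (a ++ 1 ∷ 0 ∷ ak) in eP
    ... | nothing = no λ { (k , C , T , () , _) }
    ... | just (C , T) with t (collapse (a ++ 1 ∷ 0 ∷ ak)) in eT
    ...   | nothing = no λ { (k , C' , T' , e , () , _) }
    ...   | just lam = no λ { (k , C' , T' , e , () , _) }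
    ...   | just app = no λ { (k , C' , T' , e , () , _) }
    ...   | just (var i) with i ≟ zeros ak
    ...     | no ne = no λ { (k , C' , T' , e , refl , _) → ne refl }
    ...     | yes refl with PD.node (a ++ 1 ∷ 0 ∷ ak) C T eP
    ...       | _ , itT , ru with subst (RuleAt P (a ++ 1 ∷ 0 ∷ ak) C T) eT ru
    ...         | (k , le , Ci) , _ = yes (k , C , T , refl , refl , λ z → proj₁ itT (trans (sym (single-hit k T [])) (trans (sym (Ci (k ∷ []))) z)))

    reduct-subject-under : ∀ β → t' (collapse (a ++ β)) ≡ contract 0 redexBody redexArg (collapse β)
    reduct-subject-under β = begin
      t' (collapse (a ++ β))                                             ≡⟨ reduct-subject _ ⟩
      replaceAt t b (contract 0 redexBody redexArg) (collapse (a ++ β))  ≡⟨ cong (replaceAt t b _) collapse-a++β ⟩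
      replaceAt t b (contract 0 redexBody redexArg) (b ++ collapse β)    ≡⟨ replaceAt-inside t b _ (collapse β) ⟩
      contract 0 redexBody redexArg (collapse β)                         ∎
      where
      open ≡-Reasoning
      collapse-a++β : collapse (a ++ β) ≡ b ++ collapse β
      collapse-a++β = trans (collapse-++ a β) (cong (_++ collapse β) ca)

    substFamily : Ctx → ℕ → Maybe ℕ → Ctx
    substFamily C d = redexFamily P a C d

    substFamily-track : ∀ C d k → C d (k ∷ []) ↓ → substFamily C d (just k) ≡ shiftCtxAt 0 d (ctxAt (P (a ∷ʳ k)))
    substFamily-track C d k dd with C d (k ∷ [])
    ... | just _ = refl
    ... | nothing = ⊥-elim (dd refl)

    substFamily-noTrack : ∀ C d k → C d (k ∷ []) ≡ nothing → substFamily C d (just k) ≡ emptyCtx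
    substFamily-noTrack C d k e rewrite e = refl

    reduct-inArg : ∀ β ak k γ → β ≡ ak ++ γ → IsXLeaf t P a ak k →
      LabelEq (P' (a ++ β)) (shiftLabel (zeros γ) (zeros ak) (P (a ++ k ∷ γ)))
    reduct-inArg β ak k γ eβ lf = proj₁ (proj₂ (red (a ++ β)) a β refl ca) ak k γ eβ lf

    reduct-inBody : ∀ β → (∀ ak k γ → β ≡ ak ++ γ → ¬ IsXLeaf t P a ak k) →
      PrRel P a β (P (a ++ 1 ∷ 0 ∷ β)) (P' (a ++ β))
    reduct-inBody β nl = proj₂ (proj₂ (red (a ++ β)) a β refl ca) nl

    dom-T₁ : ∀ k → 2 ≤ k → ∀ q → dom T₁ (k ∷ q) ≡ C₀ 0 (k ∷ q)
    dom-T₁ (suc (suc m)) _ q = T₁-arr (suc (suc m) ∷ q)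
    dom-T₁ zero () q
    dom-T₁ (suc zero) (s≤s ()) q

    module BoundLeaf (ak : Pos) (k : ℕ) (lf : IsXLeaf t P a ak k) where
      Cl : Ctx
      Cl = proj₁ lf
      Tl : RawTy
      Tl = proj₁ (proj₂ lf)
      eP : P (a ++ 1 ∷ 0 ∷ ak) ≡ just (Cl , Tl)
      eP = proj₁ (proj₂ (proj₂ lf))
      eT : t (collapse (a ++ 1 ∷ 0 ∷ ak)) ≡ just (var (zeros ak))
      eT = proj₁ (proj₂ (proj₂ (proj₂ lf)))
      dk : Cl (zeros ak) (k ∷ []) ↓
      dk = proj₂ (proj₂ (proj₂ (proj₂ lf)))
      leaf-node : IsCtx Cl × IsType Tl × RuleAt P (a ++ 1 ∷ 0 ∷ ak) Cl Tl (t (collapse (a ++ 1 ∷ 0 ∷ ak)))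
      leaf-node = PD.node _ Cl Tl eP
      leaf-rule : RuleAt P (a ++ 1 ∷ 0 ∷ ak) Cl Tl (just (var (zeros ak)))
      leaf-rule = subst (RuleAt P (a ++ 1 ∷ 0 ∷ ak) Cl Tl) eT (proj₂ (proj₂ leaf-node))
      k₀ : ℕ
      k₀ = proj₁ (proj₁ leaf-rule)
      Ci : Cl (zeros ak) ≈ single k₀ Tl
      Ci = proj₂ (proj₂ (proj₁ leaf-rule))
      oth : ∀ y → y ≢ zeros ak → Cl y ≈ emptySeq
      oth = proj₁ (proj₂ leaf-rule)
      nc : ∀ j → P ((a ++ 1 ∷ 0 ∷ ak) ∷ʳ j) ≡ nothing
      nc = proj₂ (proj₂ leaf-rule)
      k≡k₀ : k ≡ k₀
      k≡k₀ = single-track k₀ Tl k (λ z → dk (trans (Ci (k ∷ [])) z))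
      tracks≥2 : 2 ≤ k
      tracks≥2 = subst (2 ≤_) (sym k≡k₀) (proj₁ (proj₂ (proj₁ leaf-rule)))
      Cl-⊑-C₀ : Cl (zeros ak) ⊑ C₀ 0
      Cl-⊑-C₀ = subst (λ w → Cl w ⊑ C₀ 0) (+-identityʳ (zeros ak)) (Body.descendant-ctx-⊑ [] ak C₀ T₀ Cl Tl Pbody-root eP 0)
      k∈dom : dom T₁ (k ∷ []) ↓
      k∈dom z = dk (trans (sym (Cl-⊑-C₀ k [] dk)) (trans (sym (dom-T₁ k tracks≥2 [])) z))
      arg-premise : ∃₂ λ D S → P (a ∷ʳ k) ≡ just (D , S) × S ≈ component (dom T₁) k
      arg-premise = proj₁ (arg-premises k tracks≥2) k∈dom
      Dk : Ctx
      Dk = proj₁ arg-premise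
      Sk : RawTy
      Sk = proj₁ (proj₂ arg-premise)
      eDk : P (a ∷ʳ k) ≡ just (Dk , Sk)
      eDk = proj₁ (proj₂ (proj₂ arg-premise))
      Sk≈Tl : Sk ≈ Tl
      Sk≈Tl q = trans (proj₂ (proj₂ (proj₂ arg-premise)) q)
              (trans (dom-T₁ k tracks≥2 q) (trans (Cl-⊑-C₀ k q dk) (trans (Ci (k ∷ q))
                (subst (λ w → single k₀ Tl (w ∷ q) ≡ Tl q) (sym k≡k₀) (single-hit k₀ Tl q)))))

      reduct-at-leaf : ∃₂ λ C' T' → P' (a ++ ak) ≡ just (C' , T') × T' ≈ Tl × JoinCtx (substFamily Cl (zeros ak)) C'
      reduct-at-leaf with LabelEq-just {shiftLabel 0 (zeros ak) (P (a ∷ʳ k))} {P' (a ++ ak)}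
                     (LabelEq-sym {P' (a ++ ak)} {shiftLabel 0 (zeros ak) (P (a ∷ʳ k))}
                        (reduct-inArg ak ak k [] (sym (++-identityʳ ak)) lf))
                     (cong (shiftLabel 0 (zeros ak)) eDk)
      ... | C' , T' , e' , cc , tt' =
        C' , T' , e' , ≈-trans (≈-sym tt') Sk≈Tl , J
        where
        d = zeros ak
        okC' : IsCtx C'
        okC' = IsCtx-cong cc (shiftCtxAt-isCtx 0 d Dk (proj₁ (PD.node (a ∷ʳ k) Dk Sk eDk)))
        J : JoinCtx (substFamily Cl d) C'
        J y = join-single {G = λ i → substFamily Cl d i y} {X = C' y} (just k) (λ i → i ≟ᵏ just k) others-absent eqF
                (proj₁ (okC' y)) (proj₂ (proj₂ (proj₂ (proj₂ (okC' y)))))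
          where
          others-absent : ∀ i → ¬ i ≡ just k → ∀ k' → substFamily Cl d i y (k' ∷ []) ≡ nothing
          others-absent nothing _ k' = trans (cong (λ X → X (k' ∷ [])) (removeAt-liftIdx d Cl y)) (oth (liftIdx d y) (liftIdx≢removed d y) (k' ∷ []))
          others-absent (just k'') ne k' with nothing⊎↓ (Cl d (k'' ∷ []))
          ... | inj₁ z rewrite substFamily-noTrack Cl d k'' z = refl
          ... | inj₂ dd = ⊥-elim (ne (cong just (trans (single-track k₀ Tl k'' (λ z → dd (trans (Ci (k'' ∷ [])) z))) (sym k≡k₀))))
          eqF : substFamily Cl d (just k) y ≈ C' y
          eqF rewrite substFamily-track Cl d k dk | eDk = cc y

    reduct-label : ∀ β C T → Pbody β ≡ just (C , T) →
      ∃₂ λ C' T' → P' (a ++ β) ≡ just (C' , T') × T' ≈ T × JoinCtx (substFamily C (zeros β)) C'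
    reduct-label β C T eQ with prefix-search IsBoundLeaf isBoundLeaf? β
    ... | inj₂ nl = subst (λ x → PrRel P a β x (P' (a ++ β))) eQ (reduct-inBody β (λ ak k γ e lf → nl ak γ e (k , lf)))
    ... | inj₁ (ak , j ∷ γ , eβ , (k , lf)) =
      ⊥-elim (Body.prefix-↓ (ak ∷ʳ j) γ (λ z → ≡just⇒↓ eQ (trans (cong Pbody (trans eβ (sym (++-assoc ak (j ∷ []) γ)))) z))
               (trans (cong P (sym (++-assoc a (1 ∷ 0 ∷ ak) (j ∷ [])))) (BoundLeaf.nc ak k lf j)))
    ... | inj₁ (ak , [] , eβ , (k , lf)) with trans eβ (++-identityʳ ak)
    ...   | refl with just-injective (trans (sym eQ) (BoundLeaf.eP β k lf))
    ...     | refl = BoundLeaf.reduct-at-leaf β k lf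

    reduct-absent : ∀ β j → (∀ ak γ → β ≡ ak ++ γ → ¬ IsBoundLeaf ak) → Pbody (β ∷ʳ j) ≡ nothing → P' (a ++ (β ∷ʳ j)) ≡ nothing
    reduct-absent β j nl eQ = subst (λ x → PrRel P a (β ∷ʳ j) x (P' (a ++ (β ∷ʳ j)))) eQ (reduct-inBody (β ∷ʳ j) nl')
      where
      nl' : ∀ ak k γ → β ∷ʳ j ≡ ak ++ γ → ¬ IsXLeaf t P a ak k
      nl' ak k γ e lf with ++-≡-∷ʳ ak γ β j (sym e)
      ... | inj₁ (refl , refl) = ≡just⇒↓ (proj₁ (proj₂ (proj₂ lf))) eQ
      ... | inj₂ (γ' , eγ , ea) = nl ak γ' (sym ea) (k , lf)

    substFamily-empty : ∀ d → JoinCtx (substFamily emptyCtx d) emptyCtx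
    substFamily-empty d y = join-empty {G = λ i → substFamily emptyCtx d i y} h
      where h : ∀ i k → substFamily emptyCtx d i y (k ∷ []) ≡ nothing
            h nothing k = cong (λ X → X (k ∷ [])) (removeAt-liftIdx d emptyCtx y)
            h (just k') k = refl

    redexBody≡tbody : ∀ p → redexBody p ≡ tbody p
    redexBody≡tbody p = cong t (++-assoc b (1 ∷ 0 ∷ []) p)

    tbody-subject′ : ∀ β → t (collapse (a ++ 1 ∷ 0 ∷ β)) ≡ tbody (collapse β)
    tbody-subject′ β = trans (cong (λ w → t (collapse w)) (sym (++-assoc a (1 ∷ 0 ∷ []) β))) (tbody-subject β)

    body-path-nonLeaf : ∀ β → Pbody β ↓ → NonLeafPath redexBody β
    body-path-nonLeaf β d β₀ j β₁ e with Body.path-nonLeaf β d β₀ j β₁ e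
    ... | inj₁ z = inj₁ (trans (redexBody≡tbody _) z)
    ... | inj₂ z = inj₂ (trans (redexBody≡tbody _) z)

    module BodyNode (β : Pos) (C : Ctx) (T : RawTy) (eQ : Pbody β ≡ just (C , T))
              (nl : ∀ ak γ → β ≡ ak ++ γ → ¬ IsBoundLeaf ak) where
      d : ℕ
      d = zeros β
      Pbody-node : IsCtx C × IsType T × RuleAt Pbody β C T (tbody (collapse β))
      Pbody-node = Body.node β C T eQ
      C-isCtx : IsCtx C
      C-isCtx = proj₁ Pbody-node

      reduct-subject-body : t' (collapse (a ++ β)) ≡ contractLbl d (redexBody at collapse β) redexArg [] (tbody (collapse β))
      reduct-subject-body = begin
        t' (collapse (a ++ β))                             ≡⟨ reduct-subject-under β ⟩
        contract 0 redexBody redexArg (collapse β)         ≡⟨ cong (contract 0 redexBody redexArg) (++-identityʳ (collapse β)) ⟨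
        contract 0 redexBody redexArg (collapse β ++ [])   ≡⟨ contract-along redexBody 0 redexArg β [] (body-path-nonLeaf β (≡just⇒↓ eQ)) ⟩
        contract d (redexBody at collapse β) redexArg []   ≡⟨ cong (contractLbl d (redexBody at collapse β) redexArg []) body-label ⟩
        contractLbl d (redexBody at collapse β) redexArg [] (tbody (collapse β)) ∎
        where
        open ≡-Reasoning
        body-label : redexBody (collapse β ++ []) ≡ tbody (collapse β)
        body-label = trans (cong redexBody (++-identityʳ (collapse β))) (redexBody≡tbody (collapse β))

      C-⊑-C₀ : ∀ z → C (d + z) ⊑ C₀ z
      C-⊑-C₀ z = Body.descendant-ctx-⊑ [] β C₀ T₀ C T Pbody-root eQ z
      C₀-isCtx : IsCtx C₀
      C₀-isCtx = proj₁ (Body.node [] C₀ T₀ Pbody-root)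

      tracks≥2 : ∀ k2 → C d (k2 ∷ []) ↓ → ∃ λ m → k2 ≡ suc (suc m)
      tracks≥2 k2 dd = go k2 (⊑-↓ {C (d + 0)} {C₀ 0} (C-⊑-C₀ 0) k2 (subst (λ w → C w (k2 ∷ []) ↓) (sym (+-identityʳ d)) dd))
        where go : ∀ k2 → C₀ 0 (k2 ∷ []) ↓ → ∃ λ m → k2 ≡ suc (suc m)
              go zero d0 = ⊥-elim (d0 (proj₁ (proj₂ (C₀-isCtx 0)) []))
              go (suc zero) d0 = ⊥-elim (d0 (proj₁ (proj₂ (proj₂ (C₀-isCtx 0))) []))
              go (suc (suc m)) d0 = m , refl

      shiftedArgCtx : ℕ → Ctx
      shiftedArgCtx k2 = shiftCtxAt 0 d (ctxAt (P (a ∷ʳ k2)))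

      suc≡d+ : ∀ y → d ≤ y → suc y ≡ d + suc (y ∸ d)
      suc≡d+ y ge = trans (cong suc (sym (m+[n∸m]≡n ge))) (sym (+-suc d (y ∸ d)))

      -- Disjointness of the new contexts is inherited from the (app) node at the redex: the
      -- function premise (hence the body) and the argument premises have disjoint contexts.
      removed-vs-substituted : ∀ y k k2 → removeAt d C y (k ∷ []) ↓ → C d (k2 ∷ []) ↓ → shiftedArgCtx k2 y (k ∷ []) ↓ → ⊥
      removed-vs-substituted y k k2 r1 c2 s2 with <ᵇ-view y d
      ... | inj₁ (y<d , _) = s2 (cong (λ X → X (k ∷ [])) (shiftCtxAt0-< (ctxAt (P (a ∷ʳ k2))) y<d))
      ... | inj₂ (ge , _) with tracks≥2 k2 c2
      ...   | m , refl = nj (join-disjoint {G = λ i → appFamily C₁ P a i (y ∸ d)} {Ca (y ∸ d)} (ctx-join (y ∸ d)) nothing (just m) k c1 s2')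
        where
        nj : ¬ (nothing ≡ just m)
        nj ()
        s2' : ctxAt (P (a ∷ʳ suc (suc m))) (y ∸ d) (k ∷ []) ↓
        s2' z = s2 (trans (cong (λ X → X (k ∷ [])) (shiftCtxAt0-≥ (ctxAt (P (a ∷ʳ suc (suc m)))) ge)) z)
        r1' : C (d + suc (y ∸ d)) (k ∷ []) ↓
        r1' z = r1 (trans (cong (λ X → X (k ∷ [])) (trans (removeAt-liftIdx d C y) (cong C (trans (liftIdx-≥ ge) (suc≡d+ y ge))))) z)
        c1 : C₁ (y ∸ d) (k ∷ []) ↓
        c1 z = ⊑-↓ {C (d + suc (y ∸ d))} {C₀ (suc (y ∸ d))} (C-⊑-C₀ (suc (y ∸ d))) k r1' (trans (sym (C₁-C₀ (y ∸ d) (k ∷ []))) z)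

      substituted-disjoint : ∀ y k k1 k2 → C d (k1 ∷ []) ↓ → C d (k2 ∷ []) ↓ → shiftedArgCtx k1 y (k ∷ []) ↓ → shiftedArgCtx k2 y (k ∷ []) ↓ → k1 ≡ k2
      substituted-disjoint y k k1 k2 c1 c2 s1 s2 with <ᵇ-view y d
      ... | inj₁ (y<d , _) = ⊥-elim (s1 (cong (λ X → X (k ∷ [])) (shiftCtxAt0-< (ctxAt (P (a ∷ʳ k1))) y<d)))
      ... | inj₂ (ge , _) with tracks≥2 k1 c1 | tracks≥2 k2 c2
      ...   | m1 , refl | m2 , refl =
        cong (λ x → suc (suc x)) (just-injective (join-disjoint {G = λ i → appFamily C₁ P a i (y ∸ d)} {Ca (y ∸ d)} (ctx-join (y ∸ d)) (just m1) (just m2) k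
          (λ z → s1 (trans (cong (λ X → X (k ∷ [])) (shiftCtxAt0-≥ (ctxAt (P (a ∷ʳ suc (suc m1)))) ge)) z))
          (λ z → s2 (trans (cong (λ X → X (k ∷ [])) (shiftCtxAt0-≥ (ctxAt (P (a ∷ʳ suc (suc m2)))) ge)) z))))

      P'-child : ∀ j → P' ((a ++ β) ∷ʳ j) ≡ P' (a ++ (β ∷ʳ j))
      P'-child j = cong P' (++-assoc a β (j ∷ []))

      reduct-absent-child : ∀ j → Pbody (β ∷ʳ j) ≡ nothing → P' ((a ++ β) ∷ʳ j) ≡ nothing
      reduct-absent-child j e = trans (P'-child j) (reduct-absent β j nl e)

      reduct-label-child : ∀ j C2 T2 → Pbody (β ∷ʳ j) ≡ just (C2 , T2) →
        ∃₂ λ C' T' → P' ((a ++ β) ∷ʳ j) ≡ just (C' , T') × T' ≈ T2 × JoinCtx (substFamily C2 (zeros (β ∷ʳ j))) C'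
      reduct-label-child j C2 T2 e with reduct-label (β ∷ʳ j) C2 T2 e
      ... | C' , T' , e' , tt' , JJ = C' , T' , trans (P'-child j) e' , tt' , JJ

      body-at-β : Tm
      body-at-β = redexBody at collapse β

      module Rules (C' : Ctx) (T' : RawTy) (tt' : T' ≈ T) (JC : JoinCtx (substFamily C d) C') where

        var-rule : ∀ i → RuleAt Pbody β C T (just (var i)) → tbody (collapse β) ≡ just (var i) →
          RuleAt P' (a ++ β) C' T' (contractLbl d body-at-β redexArg [] (just (var i)))
        var-rule i ((k , le , Ci) , oth , nc) el = subst (RuleAt P' (a ++ β) C' T') (sym (contractVar-miss d i redexArg ne)) lowered-rule
          where
          ne : i ≢ d
          ne i≡d = nl β [] (sym (++-identityʳ β))
                     (k , C , T , eQ , trans (tbody-subject′ β) (trans el (cong (λ w → just (var w)) i≡d)) ,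
                      λ z → proj₁ (proj₁ (proj₂ Pbody-node)) (trans (sym (single-hit k T [])) (trans (sym (Ci (k ∷ []))) (subst (λ w → C w (k ∷ []) ≡ nothing) (sym i≡d) z))))
          C'≈removeAt : ∀ y → C' y ≈ removeAt d C y
          C'≈removeAt y = join-unique {G = λ m → substFamily C d m y} {C' y} {removeAt d C y} (JC y)
                    (join-single {G = λ m → substFamily C d m y} {X = removeAt d C y} nothing (λ m → m ≟ᵏ nothing) others-absent ≈-refl
                       (proj₁ (removeAt-isCtx d C C-isCtx y)) (proj₂ (proj₂ (proj₂ (proj₂ (removeAt-isCtx d C C-isCtx y))))))
            where
            others-absent : ∀ m → ¬ m ≡ nothing → ∀ k' → substFamily C d m y (k' ∷ []) ≡ nothing
            others-absent nothing nn k' = ⊥-elim (nn refl)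
            others-absent (just k'') _ k' rewrite substFamily-noTrack C d k'' (oth d (λ z → ne (sym z)) (k'' ∷ [])) = refl
          lowered-rule : RuleAt P' (a ++ β) C' T' (just (var (lowerIdx d i)))
          lowered-rule = (k , le , ≈-trans (C'≈removeAt (lowerIdx d i)) (≈-trans (λ p → cong (λ X → X p) (removeAt-liftIdx d C (lowerIdx d i)))
                         (≈-trans (λ p → cong (λ w → C w p) (liftIdx-lowerIdx d i ne)) (≈-trans Ci (single-cong k (≈-sym tt')))))) ,
              (λ y ny → ≈-trans (C'≈removeAt y) (≈-trans (λ p → cong (λ X → X p) (removeAt-liftIdx d C y))
                          (oth (liftIdx d y) (liftIdx≢ d i y ny)))) ,
              (λ j → reduct-absent-child j (nc j))

        abs-rule : RuleAt Pbody β C T (just lam) → RuleAt P' (a ++ β) C' T' (just lam)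
        abs-rule (nc , C0 , T0 , e0' , Tarr' , Cs') with reduct-label-child 0 C0 T0 e0'
        ... | C0' , T0' , eP0 , t0 , J0′ =
          (λ j ne → reduct-absent-child j (nc j ne)) , C0' , T0' , eP0 ,
          ≈-trans tt' (≈-trans Tarr' (arr-cong (≈-sym C0'≈C0) (≈-sym t0))) ,
          (λ y → join-unique {G = λ m → substFamily C0 (suc d) m (suc y)} {C' y} {C0' (suc y)}
                   (join-cong {G = λ m → substFamily C d m y} {λ m → substFamily C0 (suc d) m (suc y)} {C' y} {C' y} (substFamily-suc y) ≈-refl (JC y)) (J0 (suc y)))
          where
          J0 : JoinCtx (substFamily C0 (suc d)) C0'
          J0 = subst (λ w → JoinCtx (substFamily C0 w) C0') (zeros-∷ʳ-zero β) J0′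
          ic0 : IsCtx C0
          ic0 = proj₁ (Body.node (β ∷ʳ 0) C0 T0 e0')
          C0'≈C0 : C0' 0 ≈ C0 0
          C0'≈C0 = join-unique {G = λ m → substFamily C0 (suc d) m 0} {C0' 0} {C0 0} (J0 0)
                  (join-single {G = λ m → substFamily C0 (suc d) m 0} {X = C0 0} nothing (λ m → m ≟ᵏ nothing) others-absent ≈-refl
                     (proj₁ (ic0 0)) (proj₂ (proj₂ (proj₂ (proj₂ (ic0 0))))))
            where
            others-absent : ∀ m → ¬ m ≡ nothing → ∀ k' → substFamily C0 (suc d) m 0 (k' ∷ []) ≡ nothing
            others-absent nothing nn k' = ⊥-elim (nn refl)
            others-absent (just k'') _ k' with nothing⊎↓ (C0 (suc d) (k'' ∷ []))
            ... | inj₁ z rewrite substFamily-noTrack C0 (suc d) k'' z = refl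
            ... | inj₂ dd rewrite substFamily-track C0 (suc d) k'' dd = refl
          substFamily-suc : ∀ y m → substFamily C d m y ≈ substFamily C0 (suc d) m (suc y)
          substFamily-suc y nothing p = trans (cong (λ X → X p) (removeAt-liftIdx d C y))
                             (trans (Cs' (liftIdx d y) p)
                               (trans (cong (λ w → C0 w p) (sym (liftIdx-suc d y))) (sym (cong (λ X → X p) (removeAt-liftIdx (suc d) C0 (suc y))))))
          substFamily-suc y (just k') p with nothing⊎↓ (C d (k' ∷ []))
          ... | inj₁ z rewrite substFamily-noTrack C d k' z | substFamily-noTrack C0 (suc d) k' (trans (sym (Cs' d (k' ∷ []))) z) = refl
          ... | inj₂ dd rewrite substFamily-track C d k' dd | substFamily-track C0 (suc d) k' (λ z → dd (trans (Cs' d (k' ∷ [])) z)) = refl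

        module AppJoin (C1 : Ctx) (J : JoinCtx (appFamily C1 Pbody β) C) (y : ℕ) where

          orig : Maybe ℕ → Ctx
          orig = appFamily C1 Pbody β

          orig-⊑ : ∀ i x → orig i x ⊑ C x
          orig-⊑ i x = join-⊑ {G = λ i → orig i x} {C x} (J x) i

          removed-↓ : ∀ i k → substFamily (orig i) d nothing y (k ∷ []) ↓ → orig i (liftIdx d y) (k ∷ []) ↓
          removed-↓ i k dd z = dd (trans (cong (λ X → X (k ∷ [])) (removeAt-liftIdx d (orig i) y)) z)

          removed-↓-C : ∀ i k → substFamily (orig i) d nothing y (k ∷ []) ↓ → removeAt d C y (k ∷ []) ↓
          removed-↓-C i k dd z = ⊑-↓ {orig i (liftIdx d y)} {C (liftIdx d y)} (orig-⊑ i (liftIdx d y)) k (removed-↓ i k dd)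
                                   (trans (sym (cong (λ X → X (k ∷ [])) (removeAt-liftIdx d C y))) z)

          substituted-↓ : ∀ i k' k → substFamily (orig i) d (just k') y (k ∷ []) ↓ →
            orig i d (k' ∷ []) ↓ × shiftedArgCtx k' y (k ∷ []) ↓
          substituted-↓ i k' k dd with nothing⊎↓ (orig i d (k' ∷ []))
          ... | inj₁ z = ⊥-elim (dd (cong (λ X → X y (k ∷ [])) (substFamily-noTrack (orig i) d k' z)))
          ... | inj₂ di = di , λ z → dd (trans (cong (λ X → X y (k ∷ [])) (substFamily-track (orig i) d k' di)) z)

          substFamily-disjoint : ∀ i m i' m' k → substFamily (orig i) d m y (k ∷ []) ↓ →
            substFamily (orig i') d m' y (k ∷ []) ↓ → i ≡ i'
          substFamily-disjoint i nothing i' nothing k a1 a2 =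
            join-disjoint {G = λ i → orig i (liftIdx d y)} {C (liftIdx d y)} (J (liftIdx d y)) i i' k (removed-↓ i k a1) (removed-↓ i' k a2)
          substFamily-disjoint i nothing i' (just k2) k a1 a2 with substituted-↓ i' k2 k a2
          ... | o2 , s2 = ⊥-elim (removed-vs-substituted y k k2 (removed-↓-C i k a1) (⊑-↓ {orig i' d} {C d} (orig-⊑ i' d) k2 o2) s2)
          substFamily-disjoint i (just k1) i' nothing k a1 a2 with substituted-↓ i k1 k a1
          ... | o1 , s1 = ⊥-elim (removed-vs-substituted y k k1 (removed-↓-C i' k a2) (⊑-↓ {orig i d} {C d} (orig-⊑ i d) k1 o1) s1)
          substFamily-disjoint i (just k1) i' (just k2) k a1 a2 with substituted-↓ i k1 k a1 | substituted-↓ i' k2 k a2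
          ... | o1 , s1 | o2 , s2
            with substituted-disjoint y k k1 k2 (⊑-↓ {orig i d} {C d} (orig-⊑ i d) k1 o1) (⊑-↓ {orig i' d} {C d} (orig-⊑ i' d) k2 o2) s1 s2
          ...   | refl = join-disjoint {G = λ i → orig i d} {C d} (J d) i i' k1 o1 o2

          substFamily-⊑ : ∀ i m → substFamily (orig i) d m y ⊑ C' y
          substFamily-⊑ i nothing = ⊑-trans {substFamily (orig i) d nothing y} {removeAt d C y} {C' y}
                                      (subst₂ _⊑_ (sym (removeAt-liftIdx d (orig i) y)) (sym (removeAt-liftIdx d C y)) (orig-⊑ i (liftIdx d y)))
                                      (join-⊑ {G = λ m → substFamily C d m y} {C' y} (JC y) nothing)
          substFamily-⊑ i (just k') with nothing⊎↓ (orig i d (k' ∷ []))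
          ... | inj₁ z = subst (λ X → X y ⊑ C' y) (sym (substFamily-noTrack (orig i) d k' z)) (λ k q dd → ⊥-elim (dd refl))
          ... | inj₂ dd = subst (λ X → X y ⊑ C' y) (sym (substFamily-track (orig i) d k' dd))
                            (subst (λ X → X y ⊑ C' y) (substFamily-track C d k' (⊑-↓ {orig i d} {C d} (orig-⊑ i d) k' dd))
                              (join-⊑ {G = λ m → substFamily C d m y} {C' y} (JC y) (just k')))

          substFamily-covers : ∀ k → (∀ i m → substFamily (orig i) d m y (k ∷ []) ≡ nothing) → ∀ q → C' y (k ∷ q) ≡ nothing
          substFamily-covers k h q = join-outside {G = λ m → substFamily C d m y} {C' y} (JC y) k q covered
            where
            covered : ∀ m → substFamily C d m y (k ∷ []) ≡ nothing
            covered nothing = trans (cong (λ X → X (k ∷ [])) (removeAt-liftIdx d C y))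
                                (join-outside {G = λ i → orig i (liftIdx d y)} {C (liftIdx d y)} (J (liftIdx d y)) k []
                                  (λ i → trans (sym (cong (λ X → X (k ∷ [])) (removeAt-liftIdx d (orig i) y))) (h i nothing)))
            covered (just k') with nothing⊎↓ (C d (k' ∷ []))
            ... | inj₁ z rewrite substFamily-noTrack C d k' z = refl
            ... | inj₂ dd rewrite substFamily-track C d k' dd =
              decidable-stable (_ ≟ᵐ _) λ ne → dd (join-outside {G = λ i → orig i d} {C d} (J d) k' [] (λ i → untracked i ne))
              where
              untracked : ∀ i → ¬ (shiftedArgCtx k' y (k ∷ []) ≡ nothing) → orig i d (k' ∷ []) ≡ nothing
              untracked i ne with nothing⊎↓ (orig i d (k' ∷ []))
              ... | inj₁ z = z
              ... | inj₂ di = ⊥-elim (ne (trans (sym (cong (λ X → X y (k ∷ [])) (substFamily-track (orig i) d k' di))) (h i (just k'))))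

        app-rule : RuleAt Pbody β C T (just app) → RuleAt P' (a ++ β) C' T' (just app)
        app-rule (n0 , C1 , T1 , e1' , ar' , cd' , prem' , J) with reduct-label-child 1 C1 T1 e1'
        ... | C1' , T1' , eP1 , t1 , J1 =
          reduct-absent-child 0 n0 , C1' , T1' , eP1 , trans (t1 []) ar' ,
          (λ q → trans (t1 (1 ∷ q)) (trans (cd' q) (sym (tt' q)))) ,
          premises , ctx-join'
          where
          premises : ∀ k → 2 ≤ k →
            (dom T1' (k ∷ []) ↓ → ∃₂ λ D S → P' ((a ++ β) ∷ʳ k) ≡ just (D , S) × S ≈ component (dom T1') k) ×
            (dom T1' (k ∷ []) ≡ nothing → P' ((a ++ β) ∷ʳ k) ≡ nothing)
          premises k le with prem' k le
          ... | p1 , p2 =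
            (λ dd → let (D , S , eq , sc) = p1 (λ z → dd (trans (dom-cong t1 (k ∷ [])) z))
                        (D' , S' , eP , tS , _) = reduct-label-child k D S eq
                    in D' , S' , eP , (λ q → trans (tS q) (trans (sc q) (sym (dom-cong t1 (k ∷ q)))))) ,
            (λ z → reduct-absent-child k (p2 (trans (sym (dom-cong t1 (k ∷ []))) z)))
          new : Maybe ℕ → Ctx
          new = appFamily C1' P' (a ++ β)
          premise-join : ∀ i → JoinCtx (substFamily (appFamily C1 Pbody β i) d) (new i)
          premise-join nothing = subst (λ w → JoinCtx (substFamily C1 w) C1') (zeros-∷ʳ-suc β 0) J1
          premise-join (just m) with Pbody (β ∷ʳ suc (suc m)) in eq
          ... | just (D , S) with reduct-label-child (suc (suc m)) D S eq
          ...   | D' , S' , eP , _ , JJ rewrite eP = subst (λ w → JoinCtx (substFamily D w) D') (zeros-∷ʳ-suc β (suc m)) JJ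
          premise-join (just m) | nothing rewrite reduct-absent-child (suc (suc m)) eq = substFamily-empty d
          ctx-join' : JoinCtx new C'
          ctx-join' y = join-flatten _≟ᵏ_ (λ i m → substFamily (orig i) d m y) (λ i → new i y) (C' y) (λ i → premise-join i y)
                          substFamily-disjoint substFamily-⊑ substFamily-covers (join-root {G = λ m → substFamily C d m y} {C' y} (JC y))
            where open AppJoin C1 J y

      body-rule : ∀ C' T' → T' ≈ T → JoinCtx (substFamily C d) C' → RuleAt P' (a ++ β) C' T' (t' (collapse (a ++ β)))
      body-rule C' T' tt' JC = subst (RuleAt P' (a ++ β) C' T') (sym reduct-subject-body) (go (tbody (collapse β)) refl (proj₂ (proj₂ Pbody-node)))
        where
        open Rules C' T' tt' JC
        go : ∀ l → tbody (collapse β) ≡ l → RuleAt Pbody β C T l → RuleAt P' (a ++ β) C' T' (contractLbl d body-at-β redexArg [] l)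
        go nothing _ ()
        go (just (var i)) el ru = var-rule i ru el
        go (just lam) el ru = abs-rule ru
        go (just app) el ru = app-rule ru

    substFamily-isCtx : ∀ C d → IsCtx C → ∀ m → IsCtx (substFamily C d m)
    substFamily-isCtx C d ic nothing = removeAt-isCtx d C ic
    substFamily-isCtx C d ic (just k) with nothing⊎↓ (C d (k ∷ []))
    ... | inj₁ z rewrite substFamily-noTrack C d k z = emptyCtx-isCtx
    ... | inj₂ dd rewrite substFamily-track C d k dd = shiftCtxAt-isCtx 0 d (ctxAt (P (a ∷ʳ k))) (PD.ctxAt-isCtx (a ∷ʳ k))

    -- The new context at the redex is (C₀ − x) ∪ ⋃ D_k = C₁ ∪ ⋃ D_k, the context of the (app) node.
    reduct-root : LabelEq (P' a) (P a)
    reduct-root with reduct-label [] C₀ T₀ Pbody-root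
    ... | C' , T' , eP' , tt' , JC =
      subst (λ x → LabelEq x (P a)) (sym (trans (cong P' (sym (++-identityʳ a))) eP'))
        (subst (λ x → LabelEq (just (C' , T')) x) (sym ePa) labels-agree)
      where
      ic0 : IsCtx C₀
      ic0 = proj₁ (Body.node [] C₀ T₀ Pbody-root)
      substTrack⇒appTrack : ∀ y m k → substFamily C₀ 0 m y (k ∷ []) ↓ → ∃ λ i' → ∀ q → appFamily C₁ P a i' y (k ∷ q) ≡ substFamily C₀ 0 m y (k ∷ q)
      substTrack⇒appTrack y nothing k dd = nothing , λ q → C₁-C₀ y (k ∷ q)
      substTrack⇒appTrack y (just k') k dd with nothing⊎↓ (C₀ 0 (k' ∷ []))
      ... | inj₁ z = ⊥-elim (dd (cong (λ X → X y (k ∷ [])) (substFamily-noTrack C₀ 0 k' z)))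
      ... | inj₂ d0 with k'
      ...   | zero = ⊥-elim (d0 (proj₁ (proj₂ (ic0 0)) []))
      ...   | suc zero = ⊥-elim (d0 (proj₁ (proj₂ (proj₂ (ic0 0))) []))
      ...   | suc (suc m') = just m' , λ q → sym (cong (λ X → X y (k ∷ q)) (substFamily-track C₀ 0 (suc (suc m')) d0))
      appTrack⇒substTrack : ∀ y i' k → appFamily C₁ P a i' y (k ∷ []) ↓ → ∃ λ m → ∀ q → substFamily C₀ 0 m y (k ∷ q) ≡ appFamily C₁ P a i' y (k ∷ q)
      appTrack⇒substTrack y nothing k dd = nothing , λ q → sym (C₁-C₀ y (k ∷ q))
      appTrack⇒substTrack y (just m') k dd with nothing⊎↓ (dom T₁ (suc (suc m') ∷ []))
      ... | inj₁ z = ⊥-elim (dd (cong (λ X → X y (k ∷ [])) (cong ctxAt (proj₂ (arg-premises (suc (suc m')) (s≤s (s≤s z≤n))) z))))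
      ... | inj₂ dm = just (suc (suc m')) ,
            λ q → cong (λ X → X y (k ∷ q)) (substFamily-track C₀ 0 (suc (suc m')) (λ z → dm (trans (dom-T₁ (suc (suc m')) (s≤s (s≤s z≤n)) []) z)))
      labels-agree : C' ≈ᶜ Ca × T' ≈ Ta
      labels-agree = (λ y → join-≈ {G = λ m → substFamily C₀ 0 m y} {λ i → appFamily C₁ P a i y} {C' y} {Ca y} (JC y) (ctx-join y) (substTrack⇒appTrack y) (appTrack⇒substTrack y)) ,
           (λ q → trans (tt' q) (trans (sym (T₁-arr (1 ∷ q))) (T₁-cod q)))

    module ArgNode (ak : Pos) (k : ℕ) (lf : IsXLeaf t P a ak k) (γ : Pos) where
      open BoundLeaf ak k lf
      depth : ℕ
      depth = zeros ak
      Karg : DTree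
      Karg = Parg k
      label : LabelEq (P' (a ++ (ak ++ γ))) (shiftTree depth Karg γ)
      label = reduct-inArg (ak ++ γ) ak k γ refl lf
      child-label : ∀ j → LabelEq (shiftTree depth Karg (γ ∷ʳ j)) (P' ((a ++ (ak ++ γ)) ∷ʳ j))
      child-label j = LabelEq-sym {P' ((a ++ (ak ++ γ)) ∷ʳ j)} {shiftTree depth Karg (γ ∷ʳ j)}
                 (subst (λ x → LabelEq x (shiftTree depth Karg (γ ∷ʳ j))) (cong P' (sym (++-assoc a (ak ++ γ) (j ∷ []))))
                   (reduct-inArg ((ak ++ γ) ∷ʳ j) ak k (γ ∷ʳ j) (++-assoc ak γ (j ∷ [])) lf))
      leaf-subject : (redexBody at collapse ak) [] ≡ just (var depth)
      leaf-subject = trans (cong redexBody (++-identityʳ (collapse ak))) (trans (redexBody≡tbody (collapse ak)) (trans (sym (tbody-subject′ ak)) eT))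
      reduct-subject-arg : ∀ l → targ (collapse γ) ≡ just l → t' (collapse (a ++ (ak ++ γ))) ≡ just (shiftLbl depth (zeros γ) l)
      reduct-subject-arg l el = begin
        t' (collapse (a ++ (ak ++ γ)))                              ≡⟨ reduct-subject-under (ak ++ γ) ⟩
        contract 0 redexBody redexArg (collapse (ak ++ γ))          ≡⟨ cong (contract 0 redexBody redexArg) (collapse-++ ak γ) ⟩
        contract 0 redexBody redexArg (collapse ak ++ collapse γ)   ≡⟨ contract-along redexBody 0 redexArg ak (collapse γ) (body-path-nonLeaf ak (≡just⇒↓ eP)) ⟩
        contract depth (redexBody at collapse ak) redexArg (collapse γ) ≡⟨ cong (contractLbl depth (redexBody at collapse ak) redexArg (collapse γ)) leaf-subject ⟩
        contractVar depth depth redexArg (collapse γ)                     ≡⟨ contractVar-hit depth redexArg (collapse γ) ⟩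
        shiftTm depth redexArg (collapse γ)                            ≡⟨ cong (Data.Maybe.map (shiftLbl depth (zeros (collapse γ)))) arg-label ⟩
        just (shiftLbl depth (zeros (collapse γ)) l)                   ≡⟨ cong (λ w → just (shiftLbl depth w l)) (zeros-collapse γ) ⟩
        just (shiftLbl depth (zeros γ) l)                              ∎
        where
        open ≡-Reasoning
        arg-label : redexArg (collapse γ) ≡ just l
        arg-label = trans (cong t (++-assoc b (2 ∷ []) (collapse γ))) el
      arg-node : ∀ C' T' → P' (a ++ (ak ++ γ)) ≡ just (C' , T') →
        IsCtx C' × IsType T' × RuleAt P' (a ++ (ak ++ γ)) C' T' (t' (collapse (a ++ (ak ++ γ))))
      arg-node C' T' e with Karg γ in eK
      ... | nothing = ⊥-elim (≡just⇒↓ e (LabelEq-nothingʳ {P' (a ++ (ak ++ γ))} {shiftTree depth Karg γ} label (shiftTree-nothing depth Karg γ eK)))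
      ... | just (Ck , Tk) with LabelEq-just {P' (a ++ (ak ++ γ))} {shiftTree depth Karg γ} label e
      ...   | C'' , T'' , eS , cc , ttt with just-injective (trans (sym eS) (shiftTree-just depth Karg γ eK))
      ...     | refl with Subderivation.node {targ} {Parg k} (arg-isSubderivation k tracks≥2) γ Ck Tk eK
      ...       | icK , itK , ru with targ (collapse γ) in es
      ...         | nothing = ⊥-elim ru
      ...         | just l =
        IsCtx-cong (≈ᶜ-sym cc) (shiftCtxAt-isCtx (zeros γ) depth Ck icK) ,
        IsType-cong (≈-sym ttt) itK ,
        subst (RuleAt P' (a ++ (ak ++ γ)) C' T') (sym (reduct-subject-arg l es))
          (RuleAt-cong {shiftTree depth Karg} {P'} {γ} {a ++ (ak ++ γ)} (just (shiftLbl depth (zeros γ) l)) child-label (≈ᶜ-sym cc) (≈-sym ttt)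
             (shiftTree-rule depth Karg γ Ck Tk l ru))

    noBoundLeaf : ∀ β → (∀ ak γ → β ≡ ak ++ γ → ¬ IsBoundLeaf ak) → ∀ ak k γ → β ≡ ak ++ γ → ¬ IsXLeaf t P a ak k
    noBoundLeaf β nl ak k γ e lf = nl ak γ e (k , lf)

    reduct-node : ∀ β C' T' → P' (a ++ β) ≡ just (C' , T') →
      IsCtx C' × IsType T' × RuleAt P' (a ++ β) C' T' (t' (collapse (a ++ β)))
    reduct-node β C' T' e with prefix-search IsBoundLeaf isBoundLeaf? β
    ... | inj₁ (ak , γ , refl , (k , lf)) = ArgNode.arg-node ak k lf γ C' T' e
    ... | inj₂ nl with Pbody β in eq
    ...   | nothing = ⊥-elim (≡just⇒↓ e (subst (λ x → PrRel P a β x (P' (a ++ β))) eq (reduct-inBody β (noBoundLeaf β nl))))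
    ...   | just (C , T) with subst (λ x → PrRel P a β x (P' (a ++ β))) eq (reduct-inBody β (noBoundLeaf β nl))
    ...     | C'' , T'' , e'' , tt' , JC with just-injective (trans (sym e) e'')
    ...       | refl =
      joinCtx-isCtx {G = substFamily C (zeros β)} {C'} JC (substFamily-isCtx C (zeros β) (BodyNode.C-isCtx β C T eq nl)) ,
      IsType-cong (≈-sym tt') (proj₁ (proj₂ (BodyNode.Pbody-node β C T eq nl))) ,
      BodyNode.body-rule β C T eq nl C' T' tt' JC

    reduct-closed : ∀ β j → P' (a ++ (β ∷ʳ j)) ↓ → P' (a ++ β) ↓
    reduct-closed β j dP with prefix-search IsBoundLeaf isBoundLeaf? (β ∷ʳ j)
    ... | inj₂ nl with Pbody (β ∷ʳ j) in eq
    ...   | nothing = ⊥-elim (dP (subst (λ x → PrRel P a (β ∷ʳ j) x (P' (a ++ (β ∷ʳ j)))) eq (reduct-inBody (β ∷ʳ j) (noBoundLeaf (β ∷ʳ j) nl))))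
    ...   | just _ with ↓⇒just (Pbody β) (Body.closed β j (λ z → ≡just⇒↓ eq z))
    ...     | (C , T) , eQ with reduct-label β C T eQ
    ...       | _ , _ , e' , _ = ≡just⇒↓ e'
    reduct-closed β j dP | inj₁ (ak , γ , e , (k , lf)) with ++-≡-∷ʳ ak γ β j (sym e)
    ... | inj₁ (refl , refl) with ↓⇒just (Pbody β) (Body.closed β j (≡just⇒↓ (BoundLeaf.eP (β ∷ʳ j) k lf)))
    ...   | (C , T) , eQ with reduct-label β C T eQ
    ...     | _ , _ , e' , _ = ≡just⇒↓ e'
    reduct-closed β j dP | inj₁ (ak , γ , e , (k , lf)) | inj₂ (γ' , refl , refl) =
      LabelEq-↓ {shiftTree (zeros ak) (Parg k) γ'} {P' (a ++ (ak ++ γ'))} (LabelEq-sym {P' (a ++ (ak ++ γ'))} {shiftTree (zeros ak) (Parg k) γ'} (reduct-inArg (ak ++ γ') ak k γ' refl lf))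
        (shiftLabel-↓ (zeros γ') (zeros ak) (Parg k γ')
          (Subderivation.closed {targ} {Parg k} (arg-isSubderivation k (BoundLeaf.tracks≥2 ak k lf)) γ' j
            (shiftLabel-↓⁻¹ (zeros (γ' ∷ʳ j)) (zeros ak) (Parg k (γ' ∷ʳ j))
              (LabelEq-↓ {P' (a ++ ((ak ++ γ') ∷ʳ j))} {shiftTree (zeros ak) (Parg k) (γ' ∷ʳ j)}
                 (reduct-inArg ((ak ++ γ') ∷ʳ j) ak k (γ' ∷ʳ j) e lf) dP))))

  reduct-absent-redex : ∀ a → collapse a ≡ b → P a ≡ nothing → ∀ β → P' (a ++ β) ≡ nothing
  reduct-absent-redex a ca ea β = subst (λ x → PrRel P a β x (P' (a ++ β))) eQ (proj₂ (proj₂ (red (a ++ β)) a β refl ca) nl)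
    where
    eQ : P (a ++ 1 ∷ 0 ∷ β) ≡ nothing
    eQ with nothing⊎↓ (P (a ++ 1 ∷ 0 ∷ β))
    ... | inj₁ z = z
    ... | inj₂ dd = ⊥-elim (PD.prefix-↓ a (1 ∷ 0 ∷ β) dd ea)
    nl : ∀ ak k γ → β ≡ ak ++ γ → ¬ IsXLeaf t P a ak k
    nl ak k γ _ lf = PD.prefix-↓ a (1 ∷ 0 ∷ ak) (≡just⇒↓ (proj₁ (proj₂ (proj₂ lf)))) ea

  reduct-redex-root : ∀ a → collapse a ≡ b → LabelEq (P' a) (P a)
  reduct-redex-root a ca with P a in ea
  ... | nothing rewrite trans (cong P' (sym (++-identityʳ a))) (reduct-absent-redex a ca ea []) = tt
  ... | just (Ca , Ta) = subst (λ x → LabelEq (P' a) x) ea (Redex.reduct-root a ca Ca Ta ea)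

  reduct-outside : ∀ α → ¬ (b ≼ collapse α) → LabelEq (P' α) (P α)
  reduct-outside α nb = proj₁ (red α) nb

  reduct-child-outside : ∀ α → ¬ (b ≼ collapse α) → ∀ j → LabelEq (P' (α ∷ʳ j)) (P (α ∷ʳ j))
  reduct-child-outside α nb j with b ≼collapse? (α ∷ʳ j)
  ... | inj₂ nb' = reduct-outside (α ∷ʳ j) nb'
  ... | inj₁ (a' , β' , e' , ca') with ++-≡-∷ʳ a' β' α j (sym e')
  ...   | inj₁ (refl , refl) = reduct-redex-root (α ∷ʳ j) ca'
  ...   | inj₂ (β'' , _ , ea) = ⊥-elim (nb (subst (λ x → b ≼ collapse x) ea (≼-collapse-++ a' β'' ca')))

  reduct-isDerivation : IsDerivation t' P'
  reduct-isDerivation = root , closed , node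
    where
    root : P' [] ↓
    root with b ≼collapse? []
    ... | inj₂ nb = LabelEq-↓ {P []} {P' []} (LabelEq-sym {P' []} {P []} (reduct-outside [] nb)) (proj₁ der)
    ... | inj₁ ([] , [] , _ , ca) = LabelEq-↓ {P []} {P' []} (LabelEq-sym {P' []} {P []} (reduct-redex-root [] ca)) (proj₁ der)
    ... | inj₁ ([] , _ ∷ _ , () , _)
    ... | inj₁ (_ ∷ _ , _ , () , _)
    closed : ∀ α j → P' (α ∷ʳ j) ↓ → P' α ↓
    closed α j dP with b ≼collapse? α
    ... | inj₂ nb = LabelEq-↓ {P α} {P' α} (LabelEq-sym {P' α} {P α} (reduct-outside α nb))
                      (PD.closed α j (LabelEq-↓ {P' (α ∷ʳ j)} {P (α ∷ʳ j)} (reduct-child-outside α nb j) dP))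
    ... | inj₁ (a , β , refl , ca) with P a in ea
    ...   | nothing = ⊥-elim (dP (trans (cong P' (++-assoc a β (j ∷ []))) (reduct-absent-redex a ca ea (β ++ j ∷ []))))
    ...   | just (Ca , Ta) = Redex.reduct-closed a ca Ca Ta ea β j (λ z → dP (trans (cong P' (++-assoc a β (j ∷ []))) z))
    node : ∀ α C' T' → P' α ≡ just (C' , T') → IsCtx C' × IsType T' × RuleAt P' α C' T' (t' (collapse α))
    node α C' T' e with b ≼collapse? α
    ... | inj₂ nb with LabelEq-just {P' α} {P α} (reduct-outside α nb) e
    ...   | C , T , eP , cc , ttt with PD.node α C T eP
    ...     | ic , it , ru =
      IsCtx-cong (≈ᶜ-sym cc) ic , IsType-cong (≈-sym ttt) it ,
      subst (RuleAt P' α C' T') (sym (trans (reduct-subject (collapse α)) (replaceAt-outside t b _ (collapse α) nb)))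
        (RuleAt-cong {P} {P'} {α} {α} (t (collapse α)) (λ j → LabelEq-sym {P' (α ∷ʳ j)} {P (α ∷ʳ j)} (reduct-child-outside α nb j)) (≈ᶜ-sym cc) (≈-sym ttt) ru)
    node α C' T' e | inj₁ (a , β , refl , ca) with P a in ea
    ... | nothing = ⊥-elim (≡just⇒↓ e (reduct-absent-redex a ca ea β))
    ... | just (Ca , Ta) = Redex.reduct-node a ca Ca Ta ea β C' T' e

module Limit (t : ℕ → Tm) (b : ℕ → Pos) (t' : Tm) (P : ℕ → DTree)
  (steps : ∀ n → Step (b n) (t n) (t (suc n)))
  (sc : StronglyConverging b) (lim : IsLimitTm t t')
  (der₀ : IsDerivation (t 0) (P 0))
  (reds : ∀ n → IsReduct (b n) (t n) (P n) (P (suc n))) where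

  P-isDerivation : ∀ n → IsDerivation (t n) (P n)
  P-isDerivation zero = der₀
  P-isDerivation (suc n) =
    SubjectReduction.reduct-isDerivation (t n) (P n) (b n) (t (suc n)) (P (suc n)) (P-isDerivation n) (steps n) (reds n)

  Untouched : Pos → ℕ → Set
  Untouched a N = ∀ m → N ≤ m → ¬ (b m ≼ collapse a)

  -- ad (b m) ≥ ad a + 2 rules out b m ≼ collapse a and b m ≼ collapse (a ∷ʳ j).
  eventually-untouched : ∀ a → ∃ λ N → Untouched a N × (∀ j → Untouched (a ∷ʳ j) N)
  eventually-untouched a with sc (suc (suc (ad a)))
  ... | N , deep = N ,
    (λ m N≤m → ad<⇒¬≼collapse (b m) a (≤-trans (n≤1+n _) (deep m N≤m))) ,
    (λ j m N≤m → ad<⇒¬≼collapse (b m) (a ∷ʳ j) (≤-trans (s≤s (ad-∷ʳ a j)) (deep m N≤m)))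

  label-stable : ∀ a N → Untouched a N → ∀ n → N ≤ n → LabelEq (P n a) (P N a)
  label-stable a N u n N≤n = go (≤⇒≤′ N≤n)
    where
    go : ∀ {n} → N ≤′ n → LabelEq (P n a) (P N a)
    go ≤′-refl = LabelEq-refl (P N a)
    go (≤′-step {n} N≤′n) =
      LabelEq-trans {P (suc n) a} {P n a} {P N a} (proj₁ (reds n a) (u n (≤′⇒≤ N≤′n))) (go N≤′n)

  subject-stable : ∀ a N → Untouched a N → ∀ n → N ≤ n → t n (collapse a) ≡ t N (collapse a)
  subject-stable a N u n N≤n = go (≤⇒≤′ N≤n)
    where
    go : ∀ {n} → N ≤′ n → t n (collapse a) ≡ t N (collapse a)
    go ≤′-refl = refl
    go (≤′-step {n} N≤′n) =
      trans (proj₂ (proj₂ (steps n)) (collapse a))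
        (trans (replaceAt-outside (t n) (b n) _ (collapse a) (u n (≤′⇒≤ N≤′n))) (go N≤′n))

  module _ (P'' : DTree) (L : IsLimitDeriv P P'') where

    limit-label : ∀ a N → Untouched a N → LabelEq (P N a) (P'' a)
    limit-label a N u with nothing⊎↓ (P'' a)
    ... | inj₂ d with proj₂ (L a) d
    ...   | N' , agree =
      LabelEq-trans {P N a} {P (N ⊔ N') a} {P'' a}
        (LabelEq-sym {P (N ⊔ N') a} {P N a} (label-stable a N u (N ⊔ N') (m≤m⊔n N N')))
        (agree (N ⊔ N') (m≤n⊔m N N'))
    limit-label a N u | inj₁ absent with nothing⊎↓ (P N a)
    ... | inj₁ absentN = subst₂ LabelEq (sym absentN) (sym absent) tt
    ... | inj₂ d = ⊥-elim (proj₂ (proj₁ (L a))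
                     (N , λ n N≤n → LabelEq-↓ {P N a} {P n a} (LabelEq-sym {P n a} {P N a} (label-stable a N u n N≤n)) d) absent)

    limit-subject : ∀ a N → Untouched a N → t N (collapse a) ↓ → t' (collapse a) ≡ t N (collapse a)
    limit-subject a N u d with proj₂ (lim p) (proj₂ (proj₁ (lim p)) (N , λ n N≤n e → d (trans (sym (subject-stable a N u n N≤n)) e)))
      where p = collapse a
    ... | N' , agree = trans (sym (agree (N ⊔ N') (m≤n⊔m N N'))) (subject-stable a N u (N ⊔ N') (m≤m⊔n N N'))

    limit-isDerivation : IsDerivation t' P''
    limit-isDerivation = root , closed , node
      where
      root : P'' [] ↓
      root = proj₂ (proj₁ (L [])) (0 , λ n _ → proj₁ (P-isDerivation n))
      closed : ∀ α j → P'' (α ∷ʳ j) ↓ → P'' α ↓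
      closed α j d with proj₁ (proj₁ (L (α ∷ʳ j))) d
      ... | N , present = proj₂ (proj₁ (L α)) (N , λ n N≤n → proj₁ (proj₂ (P-isDerivation n)) α j (present n N≤n))
      node : ∀ α C T → P'' α ≡ just (C , T) → IsCtx C × IsType T × RuleAt P'' α C T (t' (collapse α))
      node α C T e with eventually-untouched α
      ... | N , u , uchild with LabelEq-just {P'' α} {P N α} (LabelEq-sym {P N α} {P'' α} (limit-label α N u)) e
      ...   | Cn , Tn , eN , cC , tT with proj₂ (proj₂ (P-isDerivation N)) α Cn Tn eN
      ...     | ic , it , ru =
        IsCtx-cong (≈ᶜ-sym cC) ic , IsType-cong (≈-sym tT) it ,
        subst (RuleAt P'' α C T) (sym (limit-subject α N u subject↓))
          (RuleAt-cong {P N} {P''} {α} {α} (t N (collapse α)) (λ j → limit-label (α ∷ʳ j) N (uchild j)) (≈ᶜ-sym cC) (≈-sym tT) ru)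
        where
        subject↓ : t N (collapse α) ↓
        subject↓ absent = subst (RuleAt (P N) α Cn Tn) absent ru

proposition4 : (t : ℕ → Tm) (b : ℕ → Pos) (t' : Tm) (P : ℕ → DTree) →
    (∀ n → IsTerm (t n)) → (∀ n → Is001 (t n)) →
    (∀ n → Step (b n) (t n) (t (suc n))) →
    StronglyConverging b → IsLimitTm t t' →
    IsDerivation (t 0) (P 0) → IsQuantitative (t 0) (P 0) →
    (∀ n → IsReduct (b n) (t n) (P n) (P (suc n))) →
    (∀ a → Eventually (λ n → P n a ↓) →
    ∃ λ N → ∀ n → N ≤ n → LabelEq (P n a) (P N a)) ×
    (∀ P' → IsLimitDeriv P P' → IsDerivation t' P')
proposition4 t b t' P _ _ steps sc lim der₀ _ reds = labels-stabilize , limit-isDerivation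
  where
  open Limit t b t' P steps sc lim der₀ reds
  labels-stabilize : ∀ a → Eventually (λ n → P n a ↓) → ∃ λ N → ∀ n → N ≤ n → LabelEq (P n a) (P N a)
  labels-stabilize a _ with eventually-untouched a
  ... | N , u , _ = N , label-stable a N u
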